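{- Let $R$ be a finite group of order $r$ and let $n$ be a positive integer. The number of subsets $S\subseteq R$ for which there exist a non-identity proper normal subgroup $N$ of $R$ with $|N|\le n$ and an automorphism $f\in\mathrm{Aut}(\Gamma(R,S))$ with $f\notin R$ and $f$ fixing setwise every $N$-orbit, is at most $2^{\,r-\frac{r/n-2}{3}\log_2(4/3)+(\log_2 r)^2+\log_2 r+\log_2 n-1}$.
   Context: For a finite group $R$ and $S\subseteq R$, the Cayley digraph $\Gamma(R,S)$ has vertex set $R$ and $(g,h)$ is an arc iff $hg^{ -1}\in S$. $R$ and its subgroups are identified with their images under the right regular representation in $\mathrm{Sym}(R)$; thus $R\le\mathrm{Aut}(\Gamma(R,S))$ and the $N$-orbits are the cosets of $N$. -}

module Defs where

open import Data.Nat using (ℕ; _+_; _*_; _∸_; _^_; _≤_; _<_)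
open import Data.Fin using (Fin)
open import Data.Fin.Subset using (Subset; _∈_; _∉_; ∣_∣)
open import Data.Fin.Permutation using (Permutation′; _⟨$⟩ʳ_)
open import Data.List using (List; length)
open import Data.List.Relation.Unary.All using (All)
open import Data.List.Relation.Unary.Unique.Propositional using (Unique)
open import Data.Product using (Σ; ∃; _×_)
open import Relation.Nullary using (¬_)
open import Relation.Binary.PropositionalEquality using (_≡_)
open import Algebra.Core using (Op₁; Op₂)
open import Algebra.Structures using (IsGroup)
open import Function.Bundles using (_⇔_)

-- A finite group of order r, presented (up to isomorphism) on the carrier Fin r
-- by its multiplication, identity and inverse, with propositional equality.
record FinGroup (r : ℕ) : Set where
  field
    _∙_     : Op₂ (Fin r)
    ε       : Fin r
    _⁻¹     : Op₁ (Fin r)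
    isGroup : IsGroup _≡_ _∙_ ε _⁻¹
  infixl 7 _∙_
  infix 8 _⁻¹

module _ {r : ℕ} (G : FinGroup r) where
  open FinGroup G

  record IsNormalSubgroup (N : Subset r) : Set where
    field
      ε∈     : ε ∈ N
      ∙-closed : ∀ {x y} → x ∈ N → y ∈ N → (x ∙ y) ∈ N
      ⁻¹-closed : ∀ {x} → x ∈ N → (x ⁻¹) ∈ N
      conj-closed : ∀ g {m} → m ∈ N → ((g ⁻¹) ∙ m ∙ g) ∈ N

  -- arcs of the Cayley digraph Γ(R,S): (g,h) is an arc iff h g⁻¹ ∈ S
  Arc : Subset r → Fin r → Fin r → Set
  Arc S g h = (h ∙ (g ⁻¹)) ∈ S

  IsCayleyAut : Subset r → Permutation′ r → Set
  IsCayleyAut S f = ∀ g h → Arc S g h ⇔ Arc S (f ⟨$⟩ʳ g) (f ⟨$⟩ʳ h)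

  -- f lies in (the right regular image of) R, i.e. f = (g ↦ g x) for some x
  InRightRegular : Permutation′ r → Set
  InRightRegular f = ∃ λ x → ∀ g → f ⟨$⟩ʳ g ≡ g ∙ x

  -- x lies in the N-orbit of g under the right regular action, i.e. the coset gN
  InOrbit : Subset r → Fin r → Fin r → Set
  InOrbit N g x = ∃ λ m → m ∈ N × x ≡ g ∙ m

  -- f fixes every N-orbit setwise (for a bijection: x ∈ B ⇔ f x ∈ B means f(B) = B)
  FixesOrbits : Subset r → Permutation′ r → Set
  FixesOrbits N f = ∀ g x → InOrbit N g x ⇔ InOrbit N g (f ⟨$⟩ʳ x)

  Counted : ℕ → Subset r → Set
  Counted n S =
    Σ (Subset r) λ N → IsNormalSubgroup N × 1 < ∣ N ∣ × ∣ N ∣ < r × ∣ N ∣ ≤ n ×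
    Σ (Permutation′ r) λ f → IsCayleyAut S f × ¬ InRightRegular f × FixesOrbits N f

-- Exact natural-number encoding of the real inequality
--   c ≤ 2^(r - ((r/n - 2)/3)·log₂(4/3) + (log₂ r)² + log₂ r + log₂ n - 1)   (n ≥ 1, r ≥ 1).
-- Raising to the power 3n and clearing denominators it reads
--   c^(3n)·4^r·3^(2n) ≤ (2^(r-1)·r·n)^(3n)·3^r·4^(2n)·2^(3n·L²),  L = log₂ r,
-- and since L ≥ 0 this holds iff for every rational q = a/b > L (i.e. r^b < 2^a)
--   c^(3n)·4^r·3^(2n) ≤ (2^(r-1)·r·n)^(3n)·3^r·4^(2n)·2^(3n·q²).
BoundHolds : ℕ → ℕ → ℕ → Set
BoundHolds r n c =
  ∀ a b → 0 < b → r ^ b < 2 ^ a →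
    (c ^ (3 * n) * 4 ^ r * 3 ^ (2 * n)) ^ (b * b)
      ≤ ((2 ^ (r ∸ 1) * r * n) ^ (3 * n) * 3 ^ r * 4 ^ (2 * n)) ^ (b * b)
          * 2 ^ (3 * n * (a * a))

-- An automorphism f ∉ R fixing every N-coset moves each vertex x to x d(x) with d(x) ∈ N.  Since f is
-- not a right translation there are vertices g, x in different N-cosets with d(g) ≠ d(x); then
-- u = x g⁻¹ ∉ N and v = f(x) f(g)⁻¹ ∈ uN are distinct, and the relabelling y ↦ f(yg) f(g)⁻¹ shows
-- that every coset cN contains as many y with y, y u⁻¹ ∈ S as y with y, y v⁻¹ ∈ S.  For fixed (N, u, v)
-- this balance holds in a given coset for at most 3/4 of all S (toggling a well-chosen point of S gives the
-- needed injections between the relevant families), the conditions for cosets whose blocks cN ∪ cNu⁻¹ are disjoint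
-- are independent, and greedily there are at least r/(3|N|) such cosets.  Finally N is generated by at
-- most log₂ r - 1 elements, so at most r^(log₂ r + 1) triples (N, u, v) occur.

module Submission where

open import Defs
open import Algebra.Bundles using (Group)
open import Algebra.Structures using (IsGroup)
import Algebra.Properties.CommutativeMonoid.Sum as CommutativeMonoidSum
import Algebra.Properties.Group as GroupProperties
open import Data.Bool using (Bool; true; false; _∧_; _∨_; _xor_; not; if_then_else_)
open import Data.Bool.Properties using (not-involutive; ∧-comm; ¬-not) renaming (_≟_ to _≟ᵇ_)
open import Data.Empty using (⊥-elim)
open import Data.Fin using (Fin; zero; suc; punchIn)
open import Data.Fin.Subset using (Subset; _∈_; ∣_∣)
open import Data.Fin.Subset.Properties using (anySubset?)
open import Data.Fin.Permutation using (Permutation′; permutation; _⟨$⟩ʳ_; _⟨$⟩ˡ_)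
import Data.Fin.Permutation as Permutation
open import Data.Fin.Properties using (punchInᵢ≢i; all?; ¬∀⟶∃¬) renaming (_≟_ to _≟ᶠ_)
open import Data.Nat
open import Data.Nat.Properties
open import Data.Product using (Σ; ∃-syntax; _×_; _,_; proj₁; proj₂)
open import Data.Sum using (_⊎_; inj₁; inj₂)
open import Data.Unit using (⊤; tt)
open import Data.List using (List; []; _∷_; length; map; _++_)
open import Data.List.Properties using (length-++; length-map)
open import Data.List.Relation.Unary.All as All using (All; []; _∷_)
import Data.List.Relation.Unary.All.Properties as All
open import Data.List.Relation.Unary.AllPairs as AllPairs using ([]; _∷_)
import Data.List.Relation.Unary.AllPairs.Properties as AllPairs
open import Data.List.Relation.Unary.Unique.Propositional using (Unique)
open import Data.Vec using (Vec; []; _∷_; lookup; tail; updateAt; tabulate)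
import Data.Vec.Relation.Unary.All as Vec
open import Data.Vec.Properties
  using ([]=⇒lookup; lookup⇒[]=; lookup∘updateAt; lookup∘updateAt′; updateAt-updateAt; updateAt-cong; updateAt-id; lookup∘tabulate)
open import Function using (_∘_; case_of_)
open import Function.Bundles using (Equivalence)
open import Algebra.Properties.CommutativeSemigroup +-commutativeSemigroup using (interchange)
open import Algebra.Properties.CommutativeSemigroup *-commutativeSemigroup using () renaming (interchange to *-interchange)
open import Data.Nat.Solver using (module +-*-Solver)
open import Relation.Nullary using (¬_; Dec; yes; no; does)
open import Relation.Binary.PropositionalEquality
open import Relation.Nullary.Decidable using (dec-true; dec-false; map′; _×-dec_; _→-dec_; ¬?; decidable-stable)

∧-true⁻ˡ : ∀ {a b} → (a ∧ b) ≡ true → a ≡ true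
∧-true⁻ˡ {true} _ = refl

∧-true⁻ʳ : ∀ {a b} → (a ∧ b) ≡ true → b ≡ true
∧-true⁻ʳ {true} b≡true = b≡true

∧-true⁺ : ∀ {a b} → a ≡ true → b ≡ true → (a ∧ b) ≡ true
∧-true⁺ refl refl = refl

∨-true⁺ˡ : ∀ {a b} → a ≡ true → (a ∨ b) ≡ true
∨-true⁺ˡ refl = refl

∨-true⁺ʳ : ∀ {a b} → b ≡ true → (a ∨ b) ≡ true
∨-true⁺ʳ {true}  _      = refl
∨-true⁺ʳ {false} b≡true = b≡true

∨-true⁻ : ∀ {a b} → (a ∨ b) ≡ true → a ≡ true ⊎ b ≡ true
∨-true⁻ {true}  _      = inj₁ refl
∨-true⁻ {false} b≡true = inj₂ b≡true

∨-false⁺ : ∀ {a b} → a ≡ false → b ≡ false → (a ∨ b) ≡ false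
∨-false⁺ refl refl = refl

∨-false⁻ : ∀ {a b} → (a ∨ b) ≡ false → a ≡ false × b ≡ false
∨-false⁻ {false} b≡false = refl , b≡false

not-true⁻ : ∀ {a} → not a ≡ true → a ≡ false
not-true⁻ {false} _ = refl

not-false⁻ : ∀ {a} → not a ≡ false → a ≡ true
not-false⁻ {true} _ = refl

∧-trueˡ : ∀ {a} b → a ≡ true → (a ∧ b) ≡ b
∧-trueˡ b refl = refl

∧-congˡ-guarded : ∀ a {b c} → (a ≡ true → b ≡ c) → (a ∧ b) ≡ (a ∧ c)
∧-congˡ-guarded true  b≡c = b≡c refl
∧-congˡ-guarded false _   = refl

≡-from-true⇔true : ∀ {a b} → (a ≡ true → b ≡ true) → (b ≡ true → a ≡ true) → a ≡ b
≡-from-true⇔true {true}  a⇒b _   = sym (a⇒b refl)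
≡-from-true⇔true {false} {false} _ _ = refl
≡-from-true⇔true {false} {true}  _ b⇒a = b⇒a refl

xor-false⁻ : ∀ {a b} → (a xor b) ≡ false → a ≡ b
xor-false⁻ {true}  {true}  _ = refl
xor-false⁻ {false} {false} _ = refl

xor-true⁻ : ∀ {a b} → (a xor b) ≡ true → b ≡ not a
xor-true⁻ {true}  {false} _ = refl
xor-true⁻ {false} {true}  _ = refl

not-xor-self : ∀ a → (not a xor a) ≡ true
not-xor-self true  = refl
not-xor-self false = refl

true≢false : ¬ true ≡ false
true≢false ()

does-true⁻ : ∀ {A : Set} (a? : Dec A) → does a? ≡ true → A
does-true⁻ (yes a) _ = a

bit : Bool → ℕ
bit true  = 1
bit false = 0

bit-∨+bit-∧ : ∀ a b → bit (a ∨ b) + bit (a ∧ b) ≡ bit a + bit b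
bit-∨+bit-∧ true  true  = refl
bit-∨+bit-∧ true  false = refl
bit-∨+bit-∧ false b     = +-comm (bit b) 0

bit-mono : ∀ {a b} → (a ≡ true → b ≡ true) → bit a ≤ bit b
bit-mono {true}  a⇒b rewrite a⇒b refl = ≤-refl
bit-mono {false} _   = z≤n

bit≤1 : ∀ b → bit b ≤ 1
bit≤1 true  = ≤-refl
bit≤1 false = z≤n

-- Toggling t moves the two sums in opposite directions, so they cannot both stay equal to k.
flip-separates : ∀ t a {x y k} → x + bit (t ∧ a) ≡ k + bit (not t ∧ a) →
  y + bit (t ∧ not a) ≡ k + bit (not t ∧ not a) → ¬ x ≡ y
flip-separates true  true  {x}     e₁ e₂ refl = 1+n≢0 (+-cancelˡ-≡ x 1 0 (trans e₁ (sym e₂)))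
flip-separates true  false {x}     e₁ e₂ refl = 1+n≢0 (+-cancelˡ-≡ x 1 0 (trans e₂ (sym e₁)))
flip-separates false true  {k = k} e₁ e₂ refl = 1+n≢0 (+-cancelˡ-≡ k 1 0 (trans (sym e₁) e₂))
flip-separates false false {k = k} e₁ e₂ refl = 1+n≢0 (+-cancelˡ-≡ k 1 0 (trans (sym e₂) e₁))

-- a = #matched ≤ a′ = #unmatched and b ≤ b′ split a′, so x ≤ a + b ≤ a/2 + T/2 ≤ 3T/4.
three-quarters : ∀ {a a′ b b′ x T} → a′ + a ≡ T → b + b′ ≡ a′ → a ≤ a′ → b ≤ b′ → x ≤ a + b → x * 4 ≤ 3 * T
three-quarters {a} {a′} {b} {b′} {x} {T} a′+a≡T b+b′≡a′ a≤a′ b≤b′ x≤a+b = begin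
  x * 4                   ≤⟨ *-monoˡ-≤ 4 x≤a+b ⟩
  (a + b) * 4             ≡⟨ solve 2 (λ a b → (a :+ b) :* con 4 := con 4 :* a :+ con 2 :* (b :+ b)) refl a b ⟩
  4 * a + 2 * (b + b)     ≤⟨ +-monoʳ-≤ (4 * a) (*-monoʳ-≤ 2 (+-monoʳ-≤ b b≤b′)) ⟩
  4 * a + 2 * (b + b′)    ≡⟨ cong (λ t → 4 * a + 2 * t) b+b′≡a′ ⟩
  4 * a + 2 * a′          ≡⟨ cong (_+ 2 * a′) (solve 1 (λ a → con 4 :* a := con 3 :* a :+ a) refl a) ⟩
  3 * a + a + 2 * a′      ≤⟨ +-monoˡ-≤ (2 * a′) (+-monoʳ-≤ (3 * a) a≤a′) ⟩
  3 * a + a′ + 2 * a′     ≡⟨ solve 2 (λ a a′ → con 3 :* a :+ a′ :+ con 2 :* a′ := con 3 :* (a′ :+ a)) refl a a′ ⟩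
  3 * (a′ + a)            ≡⟨ cong (3 *_) a′+a≡T ⟩
  3 * T                   ∎
  where open ≤-Reasoning
        open +-*-Solver

open CommutativeMonoidSum +-0-commutativeMonoid using (sum; sum-cong-≗; ∑-distrib-+; sum-permute; sum-remove)

count : ∀ {k} → (Fin k → Bool) → ℕ
count P = sum (bit ∘ P)

count-cong : ∀ {k} {P Q : Fin k → Bool} → (∀ i → P i ≡ Q i) → count P ≡ count Q
count-cong P≗Q = sum-cong-≗ (cong bit ∘ P≗Q)

count-mono : ∀ {k} {P Q : Fin k → Bool} → (∀ i → P i ≡ true → Q i ≡ true) → count P ≤ count Q
count-mono {zero}  _   = z≤n
count-mono {suc k} P⊆Q = +-mono-≤ (bit-mono (P⊆Q zero)) (count-mono (P⊆Q ∘ suc))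

count≤ : ∀ {k} (P : Fin k → Bool) → count P ≤ k
count≤ {zero}  _ = z≤n
count≤ {suc k} P = +-mono-≤ (bit≤1 (P zero)) (count≤ (P ∘ suc))

count-true : ∀ k → count {k} (λ _ → true) ≡ k
count-true zero    = refl
count-true (suc k) = cong suc (count-true k)

count-false : ∀ k → count {k} (λ _ → false) ≡ 0
count-false zero    = refl
count-false (suc k) = count-false k

count-∨+count-∧ : ∀ {k} (P Q : Fin k → Bool) →
  count (λ i → P i ∨ Q i) + count (λ i → P i ∧ Q i) ≡ count P + count Q
count-∨+count-∧ P Q = begin
  count (λ i → P i ∨ Q i) + count (λ i → P i ∧ Q i)  ≡⟨ ∑-distrib-+ (bit ∘ (λ i → P i ∨ Q i)) (bit ∘ (λ i → P i ∧ Q i)) ⟨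
  sum (λ i → bit (P i ∨ Q i) + bit (P i ∧ Q i))      ≡⟨ sum-cong-≗ (λ i → bit-∨+bit-∧ (P i) (Q i)) ⟩
  sum (λ i → bit (P i) + bit (Q i))                  ≡⟨ ∑-distrib-+ (bit ∘ P) (bit ∘ Q) ⟩
  count P + count Q                                  ∎
  where open ≡-Reasoning

count-∨ : ∀ {k} (P Q : Fin k → Bool) → count (λ i → P i ∨ Q i) ≤ count P + count Q
count-∨ P Q = subst (count (λ i → P i ∨ Q i) ≤_) (count-∨+count-∧ P Q) (m≤m+n _ _)

count-∘-bijection : ∀ {k} (P : Fin k → Bool) (f g : Fin k → Fin k) →
  (∀ y → f (g y) ≡ y) → (∀ x → g (f x) ≡ x) → count (P ∘ f) ≡ count P
count-∘-bijection P f g f∘g g∘f = sym (sum-permute (bit ∘ P) (permutation f g f∘g g∘f))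

count-<⁺ : ∀ {k} {P Q : Fin k → Bool} → (∀ i → P i ≡ true → Q i ≡ true) →
  ∀ y → P y ≡ false → Q y ≡ true → count P < count Q
count-<⁺ {suc k} {P} {Q} P⊆Q zero Py Qy rewrite Py | Qy = s≤s (count-mono (P⊆Q ∘ suc))
count-<⁺ {suc k} {P} {Q} P⊆Q (suc y) Py Qy =
  subst (_≤ bit (Q zero) + count (Q ∘ suc)) (+-suc (bit (P zero)) _)
    (+-mono-≤ (bit-mono (P⊆Q zero)) (count-<⁺ (P⊆Q ∘ suc) y Py Qy))

count-removeAt : ∀ {k} (P : Fin (suc k) → Bool) q → count P ≡ bit (P q) + count (P ∘ punchIn q)
count-removeAt P q = sum-remove {i = q} (bit ∘ P)

count-agree-off : ∀ {k} (P P′ : Fin k → Bool) q → (∀ y → ¬ y ≡ q → P y ≡ P′ y) →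
  count P′ + bit (P q) ≡ count P + bit (P′ q)
count-agree-off {suc k} P P′ q agree = begin
  count P′ + bit (P q)                              ≡⟨ cong (_+ bit (P q)) (count-removeAt P′ q) ⟩
  bit (P′ q) + count (P′ ∘ punchIn q) + bit (P q)   ≡⟨ cong (λ t → bit (P′ q) + t + bit (P q)) rest ⟨
  bit (P′ q) + count (P ∘ punchIn q) + bit (P q)    ≡⟨ swap-outer (bit (P′ q)) _ _ ⟩
  bit (P q) + count (P ∘ punchIn q) + bit (P′ q)    ≡⟨ cong (_+ bit (P′ q)) (count-removeAt P q) ⟨
  count P + bit (P′ q)                              ∎
  where
  open ≡-Reasoning
  rest : count (P ∘ punchIn q) ≡ count (P′ ∘ punchIn q)
  rest = count-cong (λ j → agree (punchIn q j) (punchInᵢ≢i q j))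
  swap-outer : ∀ a b c → a + b + c ≡ c + b + a
  swap-outer a b c = trans (+-comm (a + b) c) (trans (cong (c +_) (+-comm a b)) (sym (+-assoc c b a)))

∣∣≡count : ∀ {k} (p : Subset k) → ∣ p ∣ ≡ count (lookup p)
∣∣≡count []          = refl
∣∣≡count (true  ∷ p) = cong suc (∣∣≡count p)
∣∣≡count (false ∷ p) = ∣∣≡count p

anyFin : ∀ {k} → (Fin k → Bool) → Bool
anyFin {zero}  _ = false
anyFin {suc k} P = P zero ∨ anyFin (P ∘ suc)

allFin : ∀ {k} → (Fin k → Bool) → Bool
allFin {zero}  _ = true
allFin {suc k} P = P zero ∧ allFin (P ∘ suc)

anyFin-true⁺ : ∀ {k} (P : Fin k → Bool) i → P i ≡ true → anyFin P ≡ true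
anyFin-true⁺ {suc k} P zero    Pi = ∨-true⁺ˡ Pi
anyFin-true⁺ {suc k} P (suc i) Pi = ∨-true⁺ʳ {P zero} (anyFin-true⁺ (P ∘ suc) i Pi)

anyFin-true⁻ : ∀ {k} (P : Fin k → Bool) → anyFin P ≡ true → ∃[ i ] P i ≡ true
anyFin-true⁻ {suc k} P any with ∨-true⁻ {P zero} any
... | inj₁ P0 = zero , P0
... | inj₂ rest = let i , Pi = anyFin-true⁻ (P ∘ suc) rest in suc i , Pi

anyFin-false⁻ : ∀ {k} (P : Fin k → Bool) → anyFin P ≡ false → ∀ i → P i ≡ false
anyFin-false⁻ {suc k} P none zero    = proj₁ (∨-false⁻ none)
anyFin-false⁻ {suc k} P none (suc i) = anyFin-false⁻ (P ∘ suc) (proj₂ (∨-false⁻ {P zero} none)) i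

allFin-cong : ∀ {k} {P Q : Fin k → Bool} → (∀ i → P i ≡ Q i) → allFin P ≡ allFin Q
allFin-cong {zero}  _   = refl
allFin-cong {suc k} P≗Q = cong₂ _∧_ (P≗Q zero) (allFin-cong (P≗Q ∘ suc))

allFin-true⁺ : ∀ {k} (P : Fin k → Bool) → (∀ i → P i ≡ true) → allFin P ≡ true
allFin-true⁺ {zero}  P _   = refl
allFin-true⁺ {suc k} P all = ∧-true⁺ (all zero) (allFin-true⁺ (P ∘ suc) (all ∘ suc))

allFin-true⁻ : ∀ {k} (P : Fin k → Bool) → allFin P ≡ true → ∀ i → P i ≡ true
allFin-true⁻ {suc k} P all zero    = ∧-true⁻ˡ all
allFin-true⁻ {suc k} P all (suc i) = allFin-true⁻ (P ∘ suc) (∧-true⁻ʳ {P zero} all) i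

allFin-false⁻ : ∀ {k} (P : Fin k → Bool) → allFin P ≡ false → ∃[ i ] P i ≡ false
allFin-false⁻ {suc k} P notAll with P zero in P0
... | false = zero , P0
... | true  = let i , Pi = allFin-false⁻ (P ∘ suc) notAll in suc i , Pi

-- The first index at which P holds (if any); the second argument only witnesses that Fin k is inhabited.
firstTrue : ∀ {k} → (Fin k → Bool) → Fin k → Fin k
firstTrue {suc zero}    P _ = zero
firstTrue {suc (suc k)} P _ = if P zero then zero else suc (firstTrue (P ∘ suc) zero)

firstTrue-cong : ∀ {k} {P Q : Fin k → Bool} → (∀ i → P i ≡ Q i) → ∀ d → firstTrue P d ≡ firstTrue Q d
firstTrue-cong {suc zero}    _ _ = refl
firstTrue-cong {suc (suc k)} P≗Q _ = cong₂ (λ b i → if b then zero else suc i) (P≗Q zero) (firstTrue-cong (P≗Q ∘ suc) zero)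

firstTrue-true : ∀ {k} (P : Fin k → Bool) i d → P i ≡ true → P (firstTrue P d) ≡ true
firstTrue-true {suc zero}    P zero    _ Pi = Pi
firstTrue-true {suc (suc k)} P i       _ Pi with P zero in P0
... | true = P0
firstTrue-true {suc (suc k)} P zero    _ Pi | false = ⊥-elim (true≢false (trans (sym Pi) P0))
firstTrue-true {suc (suc k)} P (suc i) _ Pi | false = firstTrue-true (P ∘ suc) i zero Pi

countSubsets : ∀ {r} → (Subset r → Bool) → ℕ
countSubsets {zero}  P = bit (P [])
countSubsets {suc r} P = countSubsets (P ∘ (true ∷_)) + countSubsets (P ∘ (false ∷_))

countSubsets-cong : ∀ {r} {P Q : Subset r → Bool} → (∀ S → P S ≡ Q S) → countSubsets P ≡ countSubsets Q
countSubsets-cong {zero}  P≗Q = cong bit (P≗Q [])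
countSubsets-cong {suc r} P≗Q = cong₂ _+_ (countSubsets-cong (P≗Q ∘ (true ∷_))) (countSubsets-cong (P≗Q ∘ (false ∷_)))

countSubsets-mono : ∀ {r} {P Q : Subset r → Bool} → (∀ S → P S ≡ true → Q S ≡ true) → countSubsets P ≤ countSubsets Q
countSubsets-mono {zero}  P⊆Q = bit-mono (P⊆Q [])
countSubsets-mono {suc r} P⊆Q = +-mono-≤ (countSubsets-mono (P⊆Q ∘ (true ∷_))) (countSubsets-mono (P⊆Q ∘ (false ∷_)))

countSubsets-false : ∀ r → countSubsets {r} (λ _ → false) ≡ 0
countSubsets-false zero    = refl
countSubsets-false (suc r) = cong₂ _+_ (countSubsets-false r) (countSubsets-false r)

countSubsets-true : ∀ r → countSubsets {r} (λ _ → true) ≡ 2 ^ r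
countSubsets-true zero    = refl
countSubsets-true (suc r) = trans (cong₂ _+_ (countSubsets-true r) (countSubsets-true r)) (cong (2 ^ r +_) (sym (+-identityʳ (2 ^ r))))

countSubsets≤ : ∀ {r} (P : Subset r → Bool) → countSubsets P ≤ 2 ^ r
countSubsets≤ {r} P = ≤-trans (countSubsets-mono {r} {P} {λ _ → true} (λ _ _ → refl)) (≤-reflexive (countSubsets-true r))

countSubsets-∨ : ∀ {r} (P Q : Subset r → Bool) → countSubsets (λ S → P S ∨ Q S) ≤ countSubsets P + countSubsets Q
countSubsets-∨ {zero}  P Q = subst (bit (P [] ∨ Q []) ≤_) (bit-∨+bit-∧ (P []) (Q [])) (m≤m+n _ _)
countSubsets-∨ {suc r} P Q = ≤-trans
  (+-mono-≤ (countSubsets-∨ (P ∘ (true ∷_)) (Q ∘ (true ∷_))) (countSubsets-∨ (P ∘ (false ∷_)) (Q ∘ (false ∷_))))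
  (≤-reflexive (interchange (countSubsets (P ∘ (true ∷_))) (countSubsets (Q ∘ (true ∷_)))
                            (countSubsets (P ∘ (false ∷_))) (countSubsets (Q ∘ (false ∷_)))))

countSubsets-split : ∀ {r} (P Q : Subset r → Bool) →
  countSubsets (λ S → P S ∧ Q S) + countSubsets (λ S → P S ∧ not (Q S)) ≡ countSubsets P
countSubsets-split {zero}  P Q with P [] | Q []
... | true  | true  = refl
... | true  | false = refl
... | false | _     = refl
countSubsets-split {suc r} P Q = trans
  (interchange (countSubsets (λ S → P (true ∷ S) ∧ Q (true ∷ S))) (countSubsets (λ S → P (false ∷ S) ∧ Q (false ∷ S)))
               (countSubsets (λ S → P (true ∷ S) ∧ not (Q (true ∷ S)))) (countSubsets (λ S → P (false ∷ S) ∧ not (Q (false ∷ S)))))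
  (cong₂ _+_ (countSubsets-split (P ∘ (true ∷_)) (Q ∘ (true ∷_))) (countSubsets-split (P ∘ (false ∷_)) (Q ∘ (false ∷_))))

countSubsets-not : ∀ {r} (P : Subset r → Bool) → countSubsets P + countSubsets (not ∘ P) ≡ 2 ^ r
countSubsets-not {r} P = trans (cong (_+ countSubsets (not ∘ P)) (countSubsets-cong {r} {P} {λ S → true ∧ P S} (λ _ → refl)))
  (trans (countSubsets-split (λ _ → true) P) (countSubsets-true r))

allSubsets? : ∀ {r} {P : Subset r → Set} → (∀ S → Dec (P S)) → Dec (∀ S → P S)
allSubsets? P? = map′
  (λ ∄counterexample S → decidable-stable (P? S) (λ ¬PS → ∄counterexample (S , ¬PS)))
  (λ ∀P (S , ¬PS) → ¬PS (∀P S))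
  (¬? (anySubset? (¬? ∘ P?)))

membersWithHead : ∀ {r} → Bool → List (Subset (suc r)) → List (Subset r)
membersWithHead b     []                 = []
membersWithHead true  ((true  ∷ S) ∷ Ss) = S ∷ membersWithHead true Ss
membersWithHead true  ((false ∷ S) ∷ Ss) = membersWithHead true Ss
membersWithHead false ((true  ∷ S) ∷ Ss) = membersWithHead false Ss
membersWithHead false ((false ∷ S) ∷ Ss) = S ∷ membersWithHead false Ss

length-membersWithHead : ∀ {r} (Ss : List (Subset (suc r))) →
  length Ss ≡ length (membersWithHead true Ss) + length (membersWithHead false Ss)
length-membersWithHead []                 = refl
length-membersWithHead ((true  ∷ S) ∷ Ss) = cong suc (length-membersWithHead Ss)
length-membersWithHead ((false ∷ S) ∷ Ss) = trans (cong suc (length-membersWithHead Ss)) (sym (+-suc _ _))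

All-membersWithHead : ∀ {r} {P : Subset (suc r) → Set} b {Ss} → All P Ss → All (P ∘ (b ∷_)) (membersWithHead b Ss)
All-membersWithHead b     []                                 = []
All-membersWithHead true  {(true  ∷ S) ∷ Ss} (PS ∷ PSs) = PS ∷ All-membersWithHead true PSs
All-membersWithHead true  {(false ∷ S) ∷ Ss} (_  ∷ PSs) = All-membersWithHead true PSs
All-membersWithHead false {(true  ∷ S) ∷ Ss} (_  ∷ PSs) = All-membersWithHead false PSs
All-membersWithHead false {(false ∷ S) ∷ Ss} (PS ∷ PSs) = PS ∷ All-membersWithHead false PSs

Unique-membersWithHead : ∀ {r} b {Ss : List (Subset (suc r))} → Unique Ss → Unique (membersWithHead b Ss)
Unique-membersWithHead b     []                          = []
Unique-membersWithHead true  {(true  ∷ S) ∷ Ss} (S∉ ∷ u) =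
  All.map (_∘ cong (true ∷_)) (All-membersWithHead true S∉) ∷ Unique-membersWithHead true u
Unique-membersWithHead true  {(false ∷ S) ∷ Ss} (_  ∷ u) = Unique-membersWithHead true u
Unique-membersWithHead false {(true  ∷ S) ∷ Ss} (_  ∷ u) = Unique-membersWithHead false u
Unique-membersWithHead false {(false ∷ S) ∷ Ss} (S∉ ∷ u) =
  All.map (_∘ cong (false ∷_)) (All-membersWithHead false S∉) ∷ Unique-membersWithHead false u

length≤countSubsets : ∀ {r} (P : Subset r → Bool) (Ss : List (Subset r)) →
  Unique Ss → All (λ S → P S ≡ true) Ss → length Ss ≤ countSubsets P
length≤countSubsets {zero}  P []            _                 _        = z≤n
length≤countSubsets {zero}  P ([] ∷ [])     _                 (P[] ∷ _) rewrite P[] = ≤-refl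
length≤countSubsets {zero}  P ([] ∷ [] ∷ _) ((≢[] ∷ _) ∷ _)  _        = ⊥-elim (≢[] refl)
length≤countSubsets {suc r} P Ss            u                 PSs      = subst (_≤ countSubsets P) (sym (length-membersWithHead Ss))
  (+-mono-≤ (length≤countSubsets _ _ (Unique-membersWithHead true u)  (All-membersWithHead true PSs))
            (length≤countSubsets _ _ (Unique-membersWithHead false u) (All-membersWithHead false PSs)))

subsetsWith : ∀ {r} → (Subset r → Bool) → List (Subset r)
subsetsWith {zero}  P = if P [] then [] ∷ [] else []
subsetsWith {suc r} P = map (true ∷_) (subsetsWith (P ∘ (true ∷_))) ++ map (false ∷_) (subsetsWith (P ∘ (false ∷_)))

length-subsetsWith : ∀ {r} (P : Subset r → Bool) → length (subsetsWith P) ≡ countSubsets P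
length-subsetsWith {zero}  P with P []
... | true  = refl
... | false = refl
length-subsetsWith {suc r} P = begin
  length (map (true ∷_) ins ++ map (false ∷_) outs)
    ≡⟨ length-++ (map (true ∷_) ins) ⟩
  length (map (true ∷_) ins) + length (map (false ∷_) outs)
    ≡⟨ cong₂ _+_ (length-map (true ∷_) ins) (length-map (false ∷_) outs) ⟩
  length ins + length outs
    ≡⟨ cong₂ _+_ (length-subsetsWith (P ∘ (true ∷_))) (length-subsetsWith (P ∘ (false ∷_))) ⟩
  countSubsets P
    ∎
  where
  open ≡-Reasoning
  ins  = subsetsWith (P ∘ (true ∷_))
  outs = subsetsWith (P ∘ (false ∷_))

All-subsetsWith : ∀ {r} (P : Subset r → Bool) → All (λ S → P S ≡ true) (subsetsWith P)
All-subsetsWith {zero}  P with P [] in P[]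
... | true  = P[] ∷ []
... | false = []
All-subsetsWith {suc r} P = All.++⁺ (All.map⁺ (All-subsetsWith (P ∘ (true ∷_)))) (All.map⁺ (All-subsetsWith (P ∘ (false ∷_))))

Unique-subsetsWith : ∀ {r} (P : Subset r → Bool) → Unique (subsetsWith P)
Unique-subsetsWith {zero}  P with P []
... | true  = [] ∷ []
... | false = []
Unique-subsetsWith {suc r} P = AllPairs.++⁺
  (AllPairs.map⁺ (AllPairs.map (_∘ cong tail) (Unique-subsetsWith (P ∘ (true ∷_)))))
  (AllPairs.map⁺ (AllPairs.map (_∘ cong tail) (Unique-subsetsWith (P ∘ (false ∷_)))))
  (All.map⁺ (All.tabulate λ _ → All.map⁺ (All.tabulate λ _ ())))

Unique-map-injectiveOn : ∀ {r} (P : Subset r → Bool) (ι : Subset r → Subset r) →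
  (∀ S S′ → P S ≡ true → P S′ ≡ true → ι S ≡ ι S′ → S ≡ S′) →
  ∀ {Ss} → All (λ S → P S ≡ true) Ss → Unique Ss → Unique (map ι Ss)
Unique-map-injectiveOn P ι inj []         []         = []
Unique-map-injectiveOn P ι inj (PS ∷ PSs) (S∉ ∷ u) =
  All.map⁺ (All.zipWith (λ { (PS′ , S≢S′) → S≢S′ ∘ inj _ _ PS PS′ }) (PSs , S∉)) ∷ Unique-map-injectiveOn P ι inj PSs u

countSubsets-injection : ∀ {r} (P Q : Subset r → Bool) (ι : Subset r → Subset r) →
  (∀ S S′ → P S ≡ true → P S′ ≡ true → ι S ≡ ι S′ → S ≡ S′) →
  (∀ S → P S ≡ true → Q (ι S) ≡ true) → countSubsets P ≤ countSubsets Q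
countSubsets-injection P Q ι inj P⇒Qι =
  subst (_≤ countSubsets Q) (trans (length-map ι (subsetsWith P)) (length-subsetsWith P))
    (length≤countSubsets Q (map ι (subsetsWith P))
      (Unique-map-injectiveOn P ι inj (All-subsetsWith P) (Unique-subsetsWith P))
      (All.map⁺ (All.map (P⇒Qι _) (All-subsetsWith P))))

toggle : ∀ {r} → Fin r → Subset r → Subset r
toggle i S = updateAt S i not

toggle-involutive : ∀ {r} (i : Fin r) S → toggle i (toggle i S) ≡ S
toggle-involutive i S = trans (updateAt-updateAt i S) (trans (updateAt-cong i not-involutive S) (updateAt-id i S))

toggle-injective : ∀ {r} (i : Fin r) {S S′} → toggle i S ≡ toggle i S′ → S ≡ S′
toggle-injective i {S} {S′} eq = trans (sym (toggle-involutive i S)) (trans (cong (toggle i) eq) (toggle-involutive i S′))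

DependsOn : ∀ {r} → (Fin r → Bool) → (Subset r → Bool) → Set
DependsOn B P = ∀ S S′ → (∀ i → B i ≡ true → lookup S i ≡ lookup S′ i) → P S ≡ P S′

DependsOn-mono : ∀ {r} {B B′ : Fin r → Bool} {P} → (∀ i → B i ≡ true → B′ i ≡ true) → DependsOn B P → DependsOn B′ P
DependsOn-mono B⊆B′ dep S S′ agree = dep S S′ (λ i → agree i ∘ B⊆B′ i)

DependsOn-∧ : ∀ {r} {B B′ : Fin r → Bool} {P Q} → DependsOn B P → DependsOn B′ Q →
  DependsOn (λ i → B i ∨ B′ i) (λ S → P S ∧ Q S)
DependsOn-∧ depP depQ S S′ agree =
  cong₂ _∧_ (depP S S′ (λ i → agree i ∘ ∨-true⁺ˡ)) (depQ S S′ (λ i → agree i ∘ ∨-true⁺ʳ))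

DependsOn-head : ∀ {r} {B : Fin (suc r) → Bool} {P} → B zero ≡ false → DependsOn B P → ∀ S → P (true ∷ S) ≡ P (false ∷ S)
DependsOn-head {B = B} B0 dep S = dep (true ∷ S) (false ∷ S) agree
  where
  agree : ∀ i → B i ≡ true → lookup (true ∷ S) i ≡ lookup (false ∷ S) i
  agree zero    Bi = ⊥-elim (true≢false (trans (sym Bi) B0))
  agree (suc i) _  = refl

DependsOn-tail : ∀ {r} {B : Fin (suc r) → Bool} {P} x → DependsOn B P → DependsOn (B ∘ suc) (P ∘ (x ∷_))
DependsOn-tail x dep S S′ agree = dep (x ∷ S) (x ∷ S′) λ { zero _ → refl ; (suc i) → agree i }

private
  halves-bound : ∀ a x y b₁ b₂ t → x * t ≤ a * b₁ → y * t ≤ a * b₂ → (x + y) * (2 * t) ≤ (a + a) * (b₁ + b₂)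
  halves-bound a x y b₁ b₂ t xt≤ yt≤ = begin
    (x + y) * (2 * t)
      ≡⟨ solve 3 (λ x y t → (x :+ y) :* (con 2 :* t) := (x :* t :+ y :* t) :+ (x :* t :+ y :* t)) refl x y t ⟩
    (x * t + y * t) + (x * t + y * t)
      ≤⟨ +-mono-≤ (+-mono-≤ xt≤ yt≤) (+-mono-≤ xt≤ yt≤) ⟩
    (a * b₁ + a * b₂) + (a * b₁ + a * b₂)
      ≡⟨ solve 3 (λ a b₁ b₂ → (a :* b₁ :+ a :* b₂) :+ (a :* b₁ :+ a :* b₂) := (a :+ a) :* (b₁ :+ b₂)) refl a b₁ b₂ ⟩
    (a + a) * (b₁ + b₂)
      ∎
    where open ≤-Reasoning
          open +-*-Solver

countSubsets-headFree : ∀ {r} (Q R : Subset (suc r) → Bool) → (∀ S → Q (true ∷ S) ≡ Q (false ∷ S)) →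
  (∀ x → countSubsets (λ S → Q (x ∷ S) ∧ R (x ∷ S)) * 2 ^ r ≤ countSubsets (Q ∘ (x ∷_)) * countSubsets (R ∘ (x ∷_))) →
  countSubsets (λ S → Q S ∧ R S) * 2 ^ suc r ≤ countSubsets Q * countSubsets R
countSubsets-headFree {r} Q R Q-headFree ih = ≤-trans
  (halves-bound qₜ (both true) (both false) (countSubsets (R ∘ (true ∷_))) (countSubsets (R ∘ (false ∷_))) (2 ^ r)
    (ih true) (subst (λ q → both false * 2 ^ r ≤ q * countSubsets (R ∘ (false ∷_))) (sym qₜ≡q_f) (ih false)))
  (≤-reflexive (cong (λ q → (qₜ + q) * countSubsets R) qₜ≡q_f))
  where
  both : Bool → ℕ
  both x = countSubsets (λ S → Q (x ∷ S) ∧ R (x ∷ S))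
  qₜ = countSubsets (Q ∘ (true ∷_))
  qₜ≡q_f : qₜ ≡ countSubsets (Q ∘ (false ∷_))
  qₜ≡q_f = countSubsets-cong Q-headFree

countSubsets-∧-comm : ∀ {r} {Q R : Subset r → Bool} {t} →
  countSubsets (λ S → Q S ∧ R S) * t ≤ countSubsets Q * countSubsets R →
  countSubsets (λ S → R S ∧ Q S) * t ≤ countSubsets R * countSubsets Q
countSubsets-∧-comm {Q = Q} {R} {t} bound = subst₂ _≤_
  (cong (_* t) (countSubsets-cong (λ S → ∧-comm (Q S) (R S))))
  (*-comm (countSubsets Q) (countSubsets R))
  bound

countSubsets-independent : ∀ {r} (B : Fin r → Bool) (Q R : Subset r → Bool) →
  DependsOn B Q → DependsOn (not ∘ B) R →
  countSubsets (λ S → Q S ∧ R S) * 2 ^ r ≤ countSubsets Q * countSubsets R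
countSubsets-independent {zero}  B Q R _ _ with Q [] | R []
... | true  | true  = ≤-refl
... | true  | false = ≤-refl
... | false | _     = ≤-refl
countSubsets-independent {suc r} B Q R depQ depR with B zero in B0
... | false = countSubsets-headFree Q R (DependsOn-head B0 depQ) λ x →
  countSubsets-independent (B ∘ suc) (Q ∘ (x ∷_)) (R ∘ (x ∷_)) (DependsOn-tail x depQ) (DependsOn-tail x depR)
... | true  = countSubsets-∧-comm {suc r} {R} {Q} (countSubsets-headFree R Q (DependsOn-head (cong not B0) depR) λ x →
  countSubsets-∧-comm {r} {Q ∘ (x ∷_)}
    (countSubsets-independent (B ∘ suc) (Q ∘ (x ∷_)) (R ∘ (x ∷_)) (DependsOn-tail x depQ) (DependsOn-tail x depR)))

countSubsets-anyFin : ∀ {r k} (P : Fin k → Subset r → Bool) X → (∀ i → countSubsets (P i) ≤ X) →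
  countSubsets (λ S → anyFin (λ i → P i S)) ≤ k * X
countSubsets-anyFin {r} {zero}  P X _     = ≤-reflexive (countSubsets-false r)
countSubsets-anyFin {r} {suc k} P X bound = ≤-trans (countSubsets-∨ {r} (P zero) (λ S → anyFin (λ i → P (suc i) S)))
  (+-mono-≤ (bound zero) (countSubsets-anyFin (P ∘ suc) X (bound ∘ suc)))

anyVec : ∀ {m} k → (Vec (Fin m) k → Bool) → Bool
anyVec zero    P = P []
anyVec (suc k) P = anyFin (λ g → anyVec k (P ∘ (g ∷_)))

anyVec-true⁺ : ∀ {m} k (P : Vec (Fin m) k → Bool) v → P v ≡ true → anyVec k P ≡ true
anyVec-true⁺ zero    P []      Pv = Pv
anyVec-true⁺ (suc k) P (g ∷ v) Pv = anyFin-true⁺ _ g (anyVec-true⁺ k (P ∘ (g ∷_)) v Pv)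

countSubsets-anyVec : ∀ {r m} k (P : Vec (Fin m) k → Subset r → Bool) X → (∀ v → countSubsets (P v) ≤ X) →
  countSubsets (λ S → anyVec k (λ v → P v S)) ≤ m ^ k * X
countSubsets-anyVec         zero    P X bound = subst (countSubsets (P []) ≤_) (sym (+-identityʳ X)) (bound [])
countSubsets-anyVec {r} {m} (suc k) P X bound =
  subst (countSubsets {r} (λ S → anyVec (suc k) (λ v → P v S)) ≤_) (sym (*-assoc m (m ^ k) X))
  (countSubsets-anyFin (λ g S → anyVec k (λ v → P (g ∷ v) S)) (m ^ k * X) λ g → countSubsets-anyVec k (P ∘ (g ∷_)) X (bound ∘ (g ∷_)))

^-distribʳ-* : ∀ a b o → (a * b) ^ o ≡ a ^ o * b ^ o
^-distribʳ-* a b zero    = refl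
^-distribʳ-* a b (suc o) = trans (cong ((a * b) *_) (^-distribʳ-* a b o)) (*-interchange a b (a ^ o) (b ^ o))

-- x ≤ 2^r (3/4)^(r/3n), raised to the power 3n.
Admissible : ℕ → ℕ → ℕ → Set
Admissible r n x = x ^ (3 * n) * 4 ^ r ≤ 3 ^ r * 2 ^ (r * (3 * n))

fraction⇒admissible : ∀ r n x p s → 4 ^ p * x ≤ 3 ^ p * 2 ^ r → r ≤ p * (3 * s) → s ≤ n → Admissible r n x
fraction⇒admissible r n x p s 4ᵖx≤3ᵖ2ʳ r≤3ps s≤n = *-cancelˡ-≤ (4 ^ e) {{m^n≢0 4 e}} (begin
  4 ^ e * (x ^ W * 4 ^ r)        ≡⟨ cong (4 ^ e *_) (*-comm (x ^ W) (4 ^ r)) ⟩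
  4 ^ e * (4 ^ r * x ^ W)        ≡⟨ split 4 x ⟨
  (4 ^ p * x) ^ W                ≤⟨ ^-monoˡ-≤ W 4ᵖx≤3ᵖ2ʳ ⟩
  (3 ^ p * 2 ^ r) ^ W            ≡⟨ split 3 (2 ^ r) ⟩
  3 ^ e * (3 ^ r * (2 ^ r) ^ W)  ≡⟨ cong (λ t → 3 ^ e * (3 ^ r * t)) (^-*-assoc 2 r W) ⟩
  3 ^ e * (3 ^ r * 2 ^ (r * W))  ≤⟨ *-monoˡ-≤ _ (^-monoˡ-≤ e (n≤1+n 3)) ⟩
  4 ^ e * (3 ^ r * 2 ^ (r * W))  ∎)
  where
  open ≤-Reasoning
  W = 3 * n
  e = p * W ∸ r
  e+r≡pW : e + r ≡ p * W
  e+r≡pW = m∸n+n≡m (≤-trans r≤3ps (*-monoʳ-≤ p (*-monoʳ-≤ 3 s≤n)))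
  split : ∀ c y → (c ^ p * y) ^ W ≡ c ^ e * (c ^ r * y ^ W)
  split c y = begin-equality
    (c ^ p * y) ^ W        ≡⟨ ^-distribʳ-* (c ^ p) y W ⟩
    (c ^ p) ^ W * y ^ W    ≡⟨ cong (_* y ^ W) (^-*-assoc c p W) ⟩
    c ^ (p * W) * y ^ W    ≡⟨ cong (λ t → c ^ t * y ^ W) e+r≡pW ⟨
    c ^ (e + r) * y ^ W    ≡⟨ cong (_* y ^ W) (^-distribˡ-+-* c e r) ⟩
    c ^ e * c ^ r * y ^ W  ≡⟨ *-assoc (c ^ e) (c ^ r) (y ^ W) ⟩
    c ^ e * (c ^ r * y ^ W) ∎

Admissible? : ∀ r n x → Dec (Admissible r n x)
Admissible? r n x = _ ≤? _

-- Admissibility is not closed under sums, so the union bound needs a common admissible bound.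
largestAdmissible : ℕ → ℕ → ℕ → ℕ
largestAdmissible r n zero    = 0
largestAdmissible r n (suc k) with Admissible? r n (suc k)
... | yes _ = suc k
... | no  _ = largestAdmissible r n k

largestAdmissible-admissible : ∀ r n k → 0 < n → Admissible r n (largestAdmissible r n k)
largestAdmissible-admissible r (suc n) zero    _ = z≤n
largestAdmissible-admissible r n       (suc k) n>0 with Admissible? r n (suc k)
... | yes adm = adm
... | no  _   = largestAdmissible-admissible r n k n>0

largestAdmissible-maximal : ∀ r n k x → x ≤ k → Admissible r n x → x ≤ largestAdmissible r n k
largestAdmissible-maximal r n zero    x x≤k _   = x≤k
largestAdmissible-maximal r n (suc k) x x≤k adm with Admissible? r n (suc k)
... | yes _    = x≤k
... | no  ¬adm with m≤n⇒m<n∨m≡n x≤k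
...   | inj₁ x<1+k = largestAdmissible-maximal r n k x (≤-pred x<1+k) adm
...   | inj₂ refl  = ⊥-elim (¬adm adm)

module _ (r n K : ℕ) where
  private
    W = 3 * n

  admissible-power-bound : ∀ c X → 2 ≤ n → 1 ≤ r → c ≤ r ^ (2 + K) * X → Admissible r n X →
    c ^ W * 4 ^ r * 3 ^ (2 * n) ≤ ((2 ^ (r ∸ 1) * r * n) ^ W * 3 ^ r * 4 ^ (2 * n)) * (r ^ suc K) ^ W
  admissible-power-bound c X 2≤n 1≤r c≤ admX = begin
    c ^ W * 4 ^ r * 3 ^ (2 * n)
      ≤⟨ *-monoˡ-≤ (3 ^ (2 * n)) (*-monoˡ-≤ (4 ^ r) (^-monoˡ-≤ W c≤)) ⟩
    (r * r ^ suc K * X) ^ W * 4 ^ r * 3 ^ (2 * n)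
      ≡⟨ cong (λ t → t * 4 ^ r * 3 ^ (2 * n)) power-split ⟩
    r ^ W * T * X ^ W * 4 ^ r * 3 ^ (2 * n)
      ≡⟨ solve 5 (λ a t x f h → a :* t :* x :* f :* h := (a :* t) :* (x :* f) :* h) refl (r ^ W) T (X ^ W) (4 ^ r) (3 ^ (2 * n)) ⟩
    (r ^ W * T) * (X ^ W * 4 ^ r) * 3 ^ (2 * n)
      ≤⟨ *-monoˡ-≤ (3 ^ (2 * n)) (*-monoʳ-≤ (r ^ W * T) admX) ⟩
    (r ^ W * T) * (3 ^ r * 2 ^ (r * W)) * 3 ^ (2 * n)
      ≡⟨ cong (λ t → (r ^ W * T) * (3 ^ r * t) * 3 ^ (2 * n)) 2^rW ⟩
    (r ^ W * T) * (3 ^ r * (2 ^ W * Q)) * 3 ^ (2 * n)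
      ≡⟨ solve 6 (λ a t g v q h → (a :* t) :* (g :* (v :* q)) :* h := (a :* t :* g :* q) :* (v :* h)) refl
                 (r ^ W) T (3 ^ r) (2 ^ W) Q (3 ^ (2 * n)) ⟩
    (r ^ W * T * 3 ^ r * Q) * (2 ^ W * 3 ^ (2 * n))
      ≤⟨ *-monoʳ-≤ (r ^ W * T * 3 ^ r * Q) (*-mono-≤ (^-monoˡ-≤ W 2≤n) (^-monoˡ-≤ (2 * n) (n≤1+n 3))) ⟩
    (r ^ W * T * 3 ^ r * Q) * (n ^ W * 4 ^ (2 * n))
      ≡⟨ solve 6 (λ a t g q m f → (a :* t :* g :* q) :* (m :* f) := (q :* a :* m :* g :* f) :* t) refl
                 (r ^ W) T (3 ^ r) Q (n ^ W) (4 ^ (2 * n)) ⟩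
    (Q * r ^ W * n ^ W * 3 ^ r * 4 ^ (2 * n)) * T
      ≡⟨ cong (λ t → t * 3 ^ r * 4 ^ (2 * n) * T) base ⟨
    ((2 ^ (r ∸ 1) * r * n) ^ W * 3 ^ r * 4 ^ (2 * n)) * T
      ∎
    where
    open ≤-Reasoning
    open +-*-Solver
    T = (r ^ suc K) ^ W
    Q = 2 ^ ((r ∸ 1) * W)
    power-split : (r * r ^ suc K * X) ^ W ≡ r ^ W * T * X ^ W
    power-split = trans (^-distribʳ-* (r * r ^ suc K) X W) (cong (_* X ^ W) (^-distribʳ-* r (r ^ suc K) W))
    2^rW : 2 ^ (r * W) ≡ 2 ^ W * Q
    2^rW = trans (cong (λ t → 2 ^ (t * W)) (sym (m+[n∸m]≡n 1≤r))) (^-distribˡ-+-* 2 W ((r ∸ 1) * W))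
    base : (2 ^ (r ∸ 1) * r * n) ^ W ≡ Q * r ^ W * n ^ W
    base = trans (^-distribʳ-* (2 ^ (r ∸ 1) * r) n W)
      (cong (_* n ^ W) (trans (^-distribʳ-* (2 ^ (r ∸ 1)) r W) (cong (_* r ^ W) (^-*-assoc 2 (r ∸ 1) W))))

  -- r^b < 2^a forces (K+1) b < a.
  logarithmic-power-bound : ∀ a b → 2 ^ suc K ≤ r → r ^ b < 2 ^ a → ((r ^ suc K) ^ W) ^ (b * b) ≤ 2 ^ (W * (a * a))
  logarithmic-power-bound a b 2^K+1≤r rᵇ<2ᵃ = begin
    ((r ^ suc K) ^ W) ^ (b * b)    ≡⟨ trans (^-*-assoc (r ^ suc K) W (b * b)) (^-*-assoc r (suc K) (W * (b * b))) ⟩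
    r ^ (suc K * (W * (b * b)))    ≡⟨ cong (r ^_) (solve 3 (λ k w b → k :* (w :* (b :* b)) := b :* (k :* b :* w)) refl (suc K) W b) ⟩
    r ^ (b * (suc K * b * W))      ≡⟨ ^-*-assoc r b (suc K * b * W) ⟨
    (r ^ b) ^ (suc K * b * W)      ≤⟨ ^-monoˡ-≤ (suc K * b * W) (<⇒≤ rᵇ<2ᵃ) ⟩
    (2 ^ a) ^ (suc K * b * W)      ≡⟨ ^-*-assoc 2 a (suc K * b * W) ⟩
    2 ^ (a * (suc K * b * W))      ≤⟨ ^-monoʳ-≤ 2 (*-monoʳ-≤ a (*-monoˡ-≤ W (<⇒≤ [K+1]b<a))) ⟩
    2 ^ (a * (a * W))              ≡⟨ cong (2 ^_) (solve 2 (λ a w → a :* (a :* w) := w :* (a :* a)) refl a W) ⟩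
    2 ^ (W * (a * a))              ∎
    where
    open ≤-Reasoning
    open +-*-Solver
    [K+1]b<a : suc K * b < a
    [K+1]b<a = ≰⇒> λ a≤[K+1]b → <⇒≱ rᵇ<2ᵃ (begin
      2 ^ a             ≤⟨ ^-monoʳ-≤ 2 a≤[K+1]b ⟩
      2 ^ (suc K * b)   ≡⟨ ^-*-assoc 2 (suc K) b ⟨
      (2 ^ suc K) ^ b   ≤⟨ ^-monoˡ-≤ b 2^K+1≤r ⟩
      r ^ b             ∎)

  -- The hypothesis 0 < b of BoundHolds is only needed when c = 0.
  boundHolds : ∀ c X → 2 ≤ n → 2 ^ suc K ≤ r → c ≤ r ^ (2 + K) * X → Admissible r n X → BoundHolds r n c
  boundHolds c X 2≤n 2^K+1≤r c≤ admX a b _ rᵇ<2ᵃ = begin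
    (c ^ W * 4 ^ r * 3 ^ (2 * n)) ^ (b * b)   ≤⟨ ^-monoˡ-≤ (b * b) (admissible-power-bound c X 2≤n 1≤r c≤ admX) ⟩
    (Base * T) ^ (b * b)                      ≡⟨ ^-distribʳ-* Base T (b * b) ⟩
    Base ^ (b * b) * T ^ (b * b)              ≤⟨ *-monoʳ-≤ (Base ^ (b * b)) (logarithmic-power-bound a b 2^K+1≤r rᵇ<2ᵃ) ⟩
    Base ^ (b * b) * 2 ^ (W * (a * a))        ∎
    where
    open ≤-Reasoning
    Base = (2 ^ (r ∸ 1) * r * n) ^ W * 3 ^ r * 4 ^ (2 * n)
    T = (r ^ suc K) ^ W
    1≤r = ≤-trans (m^n>0 2 (suc K)) 2^K+1≤r

binaryLength : ∀ r → 1 ≤ r → ∃[ j ] 2 ^ j ≤ r × r < 2 ^ suc j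
binaryLength 1             _ = 0 , ≤-refl , s≤s (s≤s z≤n)
binaryLength (suc (suc r)) _ with binaryLength (suc r) (s≤s z≤n)
... | j , 2ʲ≤ , <2ʲ⁺¹ with 2 + r <? 2 ^ suc j
...   | yes <2ʲ⁺¹′ = j , m≤n⇒m≤1+n 2ʲ≤ , <2ʲ⁺¹′
...   | no  ≮2ʲ⁺¹  = suc j , ≮⇒≥ ≮2ʲ⁺¹ , ≤-trans (s≤s <2ʲ⁺¹)
  (subst (suc (2 ^ suc j) ≤_) (cong (2 ^ suc j +_) (sym (+-identityʳ (2 ^ suc j)))) (+-monoˡ-≤ (2 ^ suc j) (m^n>0 2 (suc j))))

largestExponent : ∀ r → 2 ≤ r → ∃[ K ] 2 ^ suc K ≤ r × (∀ k → 2 ^ suc k ≤ r → k ≤ K)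
largestExponent r 2≤r with binaryLength r (≤-trans (s≤s z≤n) 2≤r)
... | zero  , _   , r<2 = ⊥-elim (<⇒≱ r<2 2≤r)
... | suc K , 2ᴷ⁺¹≤r , r<2ᴷ⁺² = K , 2ᴷ⁺¹≤r , λ k 2ᵏ⁺¹≤r → ≮⇒≥ λ K<k → <⇒≱ r<2ᴷ⁺² (≤-trans (^-monoʳ-≤ 2 (s≤s K<k)) 2ᵏ⁺¹≤r)

module GroupFacts {r : ℕ} (G : FinGroup r) where

  open FinGroup G public
  open IsGroup isGroup public using (assoc; identityʳ; inverseˡ)

  group : Group _ _
  group = record { isGroup = isGroup }

  open GroupProperties group public
    using (⁻¹-involutive; ⁻¹-anti-homo-∙; ε⁻¹≈ε; ⁻¹-injective; ∙-cancelˡ;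
           \\-leftDividesˡ; \\-leftDividesʳ; //-rightDividesˡ; //-rightDividesʳ)

  -- Subgroups as Boolean predicates on the carrier, so that they can be counted and enumerated.
  record IsSubgroupᵇ (H : Fin r → Bool) : Set where
    field
      ε∈        : H ε ≡ true
      ∙-closed  : ∀ {x y} → H x ≡ true → H y ≡ true → H (x ∙ y) ≡ true
      ⁻¹-closed : ∀ {x} → H x ≡ true → H (x ⁻¹) ≡ true

    ⁻¹-∉ : ∀ {x} → H x ≡ false → H (x ⁻¹) ≡ false
    ⁻¹-∉ {x} x∉ = ¬-not λ x⁻¹∈ → true≢false (trans (sym (subst (λ t → H t ≡ true) (⁻¹-involutive x) (⁻¹-closed x⁻¹∈))) x∉)

    ∙-∉ : ∀ {x y} → H x ≡ true → H y ≡ false → H (x ∙ y) ≡ false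
    ∙-∉ {x} {y} x∈ y∉ = ¬-not λ xy∈ → true≢false
      (trans (sym (subst (λ t → H t ≡ true) (\\-leftDividesʳ x y) (∙-closed (⁻¹-closed x∈) xy∈))) y∉)

  record IsNormalSubgroupᵇ (N : Fin r → Bool) : Set where
    field
      isSubgroup  : IsSubgroupᵇ N
      conj-closed : ∀ g {m} → N m ≡ true → N (g ⁻¹ ∙ m ∙ g) ≡ true

    open IsSubgroupᵇ isSubgroup public

    conj-closed′ : ∀ g {m} → N m ≡ true → N (g ∙ m ∙ g ⁻¹) ≡ true
    conj-closed′ g {m} m∈ = subst (λ t → N (t ∙ m ∙ g ⁻¹) ≡ true) (⁻¹-involutive g) (conj-closed (g ⁻¹) m∈)

  ∙-[∙⁻¹]⁻¹ : ∀ a b c → a ∙ (b ∙ c ⁻¹) ⁻¹ ≡ a ∙ c ∙ b ⁻¹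
  ∙-[∙⁻¹]⁻¹ a b c = trans (cong (a ∙_) (trans (⁻¹-anti-homo-∙ b (c ⁻¹)) (cong (_∙ b ⁻¹) (⁻¹-involutive c)))) (sym (assoc a c (b ⁻¹)))

  ∙ε⁻¹ : ∀ a → a ∙ ε ⁻¹ ≡ a
  ∙ε⁻¹ a = trans (cong (a ∙_) ε⁻¹≈ε) (identityʳ a)

  IsSubgroupᵇ-cong : ∀ {H H′} → (∀ y → H y ≡ H′ y) → IsSubgroupᵇ H → IsSubgroupᵇ H′
  IsSubgroupᵇ-cong {H} {H′} H≗H′ isSubgroup = record
    { ε∈        = move ε∈
    ; ∙-closed  = λ x∈ y∈ → move (∙-closed (back x∈) (back y∈))
    ; ⁻¹-closed = λ x∈ → move (⁻¹-closed (back x∈))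
    }
    where
    open IsSubgroupᵇ isSubgroup
    move : ∀ {y} → H y ≡ true → H′ y ≡ true
    move {y} = trans (sym (H≗H′ y))
    back : ∀ {y} → H′ y ≡ true → H y ≡ true
    back {y} = trans (H≗H′ y)

  IsNormalSubgroupᵇ-cong : ∀ {N N′} → (∀ y → N y ≡ N′ y) → IsNormalSubgroupᵇ N → IsNormalSubgroupᵇ N′
  IsNormalSubgroupᵇ-cong {N} {N′} N≗N′ normal = record
    { isSubgroup  = IsSubgroupᵇ-cong N≗N′ isSubgroup
    ; conj-closed = λ g {m} m∈ → trans (sym (N≗N′ _)) (conj-closed g (trans (N≗N′ m) m∈))
    }
    where open IsNormalSubgroupᵇ normal

  IsSubgroupᵇ? : ∀ H → Dec (IsSubgroupᵇ H)
  IsSubgroupᵇ? H = map′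
    (λ (ε∈ , ∙-closed , ⁻¹-closed) → record { ε∈ = ε∈ ; ∙-closed = ∙-closed _ _ ; ⁻¹-closed = ⁻¹-closed _ })
    (λ isSubgroup → let open IsSubgroupᵇ isSubgroup in ε∈ , (λ _ _ → ∙-closed) , (λ _ → ⁻¹-closed))
    ((H ε ≟ᵇ true) ×-dec (all? λ x → all? λ y → (H x ≟ᵇ true) →-dec (H y ≟ᵇ true) →-dec (H (x ∙ y) ≟ᵇ true))
                   ×-dec (all? λ x → (H x ≟ᵇ true) →-dec (H (x ⁻¹) ≟ᵇ true)))

  IsNormalSubgroupᵇ? : ∀ N → Dec (IsNormalSubgroupᵇ N)
  IsNormalSubgroupᵇ? N = map′
    (λ (isSubgroup , conj-closed) → record { isSubgroup = isSubgroup ; conj-closed = λ g → conj-closed g _ })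
    (λ normal → let open IsNormalSubgroupᵇ normal in isSubgroup , λ g _ → conj-closed g)
    (IsSubgroupᵇ? N ×-dec (all? λ g → all? λ m → (N m ≟ᵇ true) →-dec (N (g ⁻¹ ∙ m ∙ g) ≟ᵇ true)))

module Balance {r : ℕ} (G : FinGroup r) where

  open GroupFacts G

  inCoset : (Fin r → Bool) → Fin r → Fin r → Bool
  inCoset N c y = N (c ⁻¹ ∙ y)

  -- y ∈ cN is an out-neighbour of both ε and w in Γ(R,S).
  commonOutNeighbour : (Fin r → Bool) → Fin r → Fin r → Subset r → Fin r → Bool
  commonOutNeighbour N w c S y = inCoset N c y ∧ (lookup S y ∧ lookup S (y ∙ w ⁻¹))

  balancedAt : (Fin r → Bool) → Fin r → Fin r → Fin r → Subset r → Bool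
  balancedAt N u v c S = does (count (commonOutNeighbour N u c S) ≟ count (commonOutNeighbour N v c S))

  balanced : (Fin r → Bool) → Fin r → Fin r → Subset r → Bool
  balanced N u v S = allFin λ c → balancedAt N u v c S

  balanced-cong : ∀ {N N′} → (∀ y → N y ≡ N′ y) → ∀ u v S → balanced N u v S ≡ balanced N′ u v S
  balanced-cong {N} {N′} N≗N′ u v S = allFin-cong λ c → cong₂ (λ a b → does (a ≟ b)) (neighbours u c) (neighbours v c)
    where
    neighbours : ∀ w c → count (commonOutNeighbour N w c S) ≡ count (commonOutNeighbour N′ w c S)
    neighbours w c = count-cong λ y → cong (_∧ (lookup S y ∧ lookup S (y ∙ w ⁻¹))) (N≗N′ (c ⁻¹ ∙ y))

  module _ (N : Fin r → Bool) (normal : IsNormalSubgroupᵇ N) where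

    open IsNormalSubgroupᵇ normal

    _∼_ : Fin r → Fin r → Set
    a ∼ b = N (a ⁻¹ ∙ b) ≡ true

    ∼-refl : ∀ a → a ∼ a
    ∼-refl a = subst (λ t → N t ≡ true) (sym (inverseˡ a)) ε∈

    ∼-sym : ∀ {a b} → a ∼ b → b ∼ a
    ∼-sym {a} {b} a∼b = subst (λ t → N t ≡ true)
      (trans (⁻¹-anti-homo-∙ (a ⁻¹) b) (cong (b ⁻¹ ∙_) (⁻¹-involutive a))) (⁻¹-closed a∼b)

    ∼-trans : ∀ {a b c} → a ∼ b → b ∼ c → a ∼ c
    ∼-trans {a} {b} {c} a∼b b∼c = subst (λ t → N t ≡ true)
      (trans (assoc (a ⁻¹) b (b ⁻¹ ∙ c)) (cong (a ⁻¹ ∙_) (\\-leftDividesˡ b c))) (∙-closed a∼b b∼c)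

    ∼-∙ʳ : ∀ {a b} g → a ∼ b → (a ∙ g) ∼ (b ∙ g)
    ∼-∙ʳ {a} {b} g a∼b = subst (λ t → N t ≡ true) conjugate (conj-closed g a∼b)
      where
      conjugate : g ⁻¹ ∙ (a ⁻¹ ∙ b) ∙ g ≡ (a ∙ g) ⁻¹ ∙ (b ∙ g)
      conjugate = begin
        g ⁻¹ ∙ (a ⁻¹ ∙ b) ∙ g   ≡⟨ cong (_∙ g) (assoc (g ⁻¹) (a ⁻¹) b) ⟨
        g ⁻¹ ∙ a ⁻¹ ∙ b ∙ g     ≡⟨ assoc (g ⁻¹ ∙ a ⁻¹) b g ⟩
        g ⁻¹ ∙ a ⁻¹ ∙ (b ∙ g)   ≡⟨ cong (_∙ (b ∙ g)) (⁻¹-anti-homo-∙ a g) ⟨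
        (a ∙ g) ⁻¹ ∙ (b ∙ g)    ∎
        where open ≡-Reasoning

    ∼-∙-member : ∀ a {k} → N k ≡ true → a ∼ (a ∙ k)
    ∼-∙-member a {k} k∈ = subst (λ t → N t ≡ true) (sym (\\-leftDividesʳ a k)) k∈

    inCoset-resp : ∀ c {y y′} → y ∼ y′ → inCoset N c y′ ≡ inCoset N c y
    inCoset-resp c y∼y′ = ≡-from-true⇔true (λ c∼y′ → ∼-trans c∼y′ (∼-sym y∼y′)) (λ c∼y → ∼-trans c∼y y∼y′)

    module Bound (u v : Fin r) (u∉N : N u ≡ false) (u∼v : u ∼ v) (u≢v : ¬ u ≡ v) where

      u∼u : u ∼ u
      u∼u = ∼-refl u

      -- Every w ∼ u maps cN onto the same coset cNu⁻¹, which is disjoint from cN.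
      shift-into : ∀ c y {w} → u ∼ w → inCoset N c y ≡ true → inCoset N c (y ∙ w ⁻¹ ∙ u) ≡ true
      shift-into c y {w} u∼w c∼y = ∼-trans c∼y
        (subst (y ∼_) (sym (assoc y (w ⁻¹) u)) (∼-∙-member y (∼-sym u∼w)))

      shift-out : ∀ c y → inCoset N c y ≡ true → inCoset N c (y ∙ u) ≡ false
      shift-out c y c∼y = trans (cong N (sym (assoc (c ⁻¹) y u))) (∙-∉ c∼y u∉N)

      block : Fin r → Fin r → Bool
      block c y = inCoset N c y ∨ inCoset N c (y ∙ u)

      balancedAt-dependsOn : ∀ c → DependsOn (block c) (balancedAt N u v c)
      balancedAt-dependsOn c S S′ agree =
        cong₂ (λ a b → does (a ≟ b)) (count-cong (sameNeighbours u∼u)) (count-cong (sameNeighbours u∼v))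
        where
        sameNeighbours : ∀ {w} → u ∼ w → ∀ y → commonOutNeighbour N w c S y ≡ commonOutNeighbour N w c S′ y
        sameNeighbours {w} u∼w y = ∧-congˡ-guarded (inCoset N c y) λ c∼y →
          cong₂ _∧_ (agree y (∨-true⁺ˡ c∼y)) (agree (y ∙ w ⁻¹) (∨-true⁺ʳ (shift-into c y u∼w c∼y)))

      module OneCoset (c : Fin r) where

        mismatch : Subset r → Fin r → Bool
        mismatch S y = inCoset N c y ∧ (lookup S (y ∙ u ⁻¹) xor lookup S (y ∙ v ⁻¹))

        unmatched : Subset r → Bool
        unmatched S = anyFin (mismatch S)

        c∈cN : inCoset N c c ≡ true
        c∈cN = ∼-refl c

        neighbours : Fin r → Subset r → ℕ
        neighbours w S = count (commonOutNeighbour N w c S)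

        toggle-preserves-shifts : ∀ S {q y w} → inCoset N c q ≡ true → inCoset N c y ≡ true → u ∼ w →
          lookup (toggle q S) (y ∙ w ⁻¹) ≡ lookup S (y ∙ w ⁻¹)
        toggle-preserves-shifts S {q} {y} {w} c∼q c∼y u∼w = lookup∘updateAt′ (y ∙ w ⁻¹) q shift≢q S
          where
          shift≢q : ¬ y ∙ w ⁻¹ ≡ q
          shift≢q eq = true≢false
            (trans (sym (shift-into c y u∼w c∼y)) (trans (cong (λ t → inCoset N c (t ∙ u)) eq) (shift-out c q c∼q)))

        mismatch-toggle : ∀ S {q} → inCoset N c q ≡ true → ∀ y → mismatch (toggle q S) y ≡ mismatch S y
        mismatch-toggle S c∼q y = ∧-congˡ-guarded (inCoset N c y) λ c∼y →
          cong₂ _xor_ (toggle-preserves-shifts S c∼q c∼y u∼u) (toggle-preserves-shifts S c∼q c∼y u∼v)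

        -- Toggling c u⁻¹ creates a mismatch at c, because c v⁻¹ ≠ c u⁻¹.
        unmatched-toggle : ∀ S → unmatched S ≡ false → unmatched (toggle (c ∙ u ⁻¹) S) ≡ true
        unmatched-toggle S matchedS = anyFin-true⁺ _ c (∧-true⁺ c∈cN flipped)
          where
          d≢d′ : ¬ c ∙ v ⁻¹ ≡ c ∙ u ⁻¹
          d≢d′ eq = u≢v (sym (⁻¹-injective (∙-cancelˡ c _ _ eq)))
          unchanged : lookup S (c ∙ u ⁻¹) ≡ lookup S (c ∙ v ⁻¹)
          unchanged = xor-false⁻ (trans (sym (∧-trueˡ _ c∈cN)) (anyFin-false⁻ (mismatch S) matchedS c))
          flipped : (lookup (toggle (c ∙ u ⁻¹) S) (c ∙ u ⁻¹) xor lookup (toggle (c ∙ u ⁻¹) S) (c ∙ v ⁻¹)) ≡ true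
          flipped = begin
            lookup (toggle (c ∙ u ⁻¹) S) (c ∙ u ⁻¹) xor lookup (toggle (c ∙ u ⁻¹) S) (c ∙ v ⁻¹)
              ≡⟨ cong₂ _xor_ (lookup∘updateAt (c ∙ u ⁻¹) S) (lookup∘updateAt′ (c ∙ v ⁻¹) (c ∙ u ⁻¹) d≢d′ S) ⟩
            not (lookup S (c ∙ u ⁻¹)) xor lookup S (c ∙ v ⁻¹)
              ≡⟨ cong (not (lookup S (c ∙ u ⁻¹)) xor_) unchanged ⟨
            not (lookup S (c ∙ u ⁻¹)) xor lookup S (c ∙ u ⁻¹)
              ≡⟨ not-xor-self (lookup S (c ∙ u ⁻¹)) ⟩
            true ∎
            where open ≡-Reasoning

        matched≤unmatched : countSubsets (not ∘ unmatched) ≤ countSubsets unmatched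
        matched≤unmatched = countSubsets-injection (not ∘ unmatched) unmatched (toggle (c ∙ u ⁻¹))
          (λ _ _ _ _ → toggle-injective (c ∙ u ⁻¹)) (λ S → unmatched-toggle S ∘ not-true⁻)

        firstMismatch : Subset r → Fin r
        firstMismatch S = firstTrue (mismatch S) c

        -- Toggling the first mismatch keeps S unmatched but destroys the balance at c.
        flipFirstMismatch : Subset r → Subset r
        flipFirstMismatch S = toggle (firstMismatch S) S

        module _ (S : Subset r) (unmatchedS : unmatched S ≡ true) where

          private
            q = firstMismatch S
            S′ = flipFirstMismatch S

          firstMismatch-mismatch : mismatch S q ≡ true
          firstMismatch-mismatch = let y , mismatch-y = anyFin-true⁻ (mismatch S) unmatchedS in
            firstTrue-true (mismatch S) y c mismatch-y

          firstMismatch∈cN : inCoset N c q ≡ true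
          firstMismatch∈cN = ∧-true⁻ˡ firstMismatch-mismatch

          mismatch-flip : ∀ y → mismatch S′ y ≡ mismatch S y
          mismatch-flip = mismatch-toggle S firstMismatch∈cN

          unmatched-flip : unmatched S′ ≡ true
          unmatched-flip = anyFin-true⁺ _ q (trans (mismatch-flip q) firstMismatch-mismatch)

          count-flip : ∀ {w} → u ∼ w →
            neighbours w S′ + bit (lookup S q ∧ lookup S (q ∙ w ⁻¹)) ≡ neighbours w S + bit (not (lookup S q) ∧ lookup S (q ∙ w ⁻¹))
          count-flip {w} u∼w = subst₂ (λ p p′ → neighbours w S′ + bit p ≡ neighbours w S + bit p′)
            (∧-trueˡ _ firstMismatch∈cN)
            (trans (∧-trueˡ _ firstMismatch∈cN)
                   (cong₂ _∧_ (lookup∘updateAt q S) (toggle-preserves-shifts S firstMismatch∈cN firstMismatch∈cN u∼w)))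
            (count-agree-off (commonOutNeighbour N w c S) (commonOutNeighbour N w c S′) q agree)
            where
            agree : ∀ y → ¬ y ≡ q → commonOutNeighbour N w c S y ≡ commonOutNeighbour N w c S′ y
            agree y y≢q = ∧-congˡ-guarded (inCoset N c y) λ c∼y →
              sym (cong₂ _∧_ (lookup∘updateAt′ y q y≢q S) (toggle-preserves-shifts S firstMismatch∈cN c∼y u∼w))

          unbalanced-flip : balancedAt N u v c S ≡ true → balancedAt N u v c S′ ≡ false
          unbalanced-flip balancedS = dec-false (neighbours u S′ ≟ neighbours v S′)
            (flip-separates (lookup S q) (lookup S (q ∙ u ⁻¹)) (count-flip u∼u)
              (subst₂ (λ k b → neighbours v S′ + bit (lookup S q ∧ b) ≡ k + bit (not (lookup S q) ∧ b))
                (sym (does-true⁻ (neighbours u S ≟ neighbours v S) balancedS))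
                (xor-true⁻ (∧-true⁻ʳ firstMismatch-mismatch))
                (count-flip u∼v)))

        flipFirstMismatch-injective : ∀ S S′ → unmatched S ≡ true → unmatched S′ ≡ true →
          flipFirstMismatch S ≡ flipFirstMismatch S′ → S ≡ S′
        flipFirstMismatch-injective S S′ unmatchedS unmatchedS′ eq =
          toggle-injective (firstMismatch S) (trans eq (cong (λ i → toggle i S′) (sym sameFirst)))
          where
          sameFirst : firstMismatch S ≡ firstMismatch S′
          sameFirst = firstTrue-cong (λ y → trans (sym (mismatch-flip S unmatchedS y))
            (trans (cong (λ T → mismatch T y) eq) (mismatch-flip S′ unmatchedS′ y))) c

        unmatched-balanced≤unbalanced :
          countSubsets (λ S → unmatched S ∧ balancedAt N u v c S) ≤ countSubsets (λ S → unmatched S ∧ not (balancedAt N u v c S))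
        unmatched-balanced≤unbalanced = countSubsets-injection _ _ flipFirstMismatch
          (λ S S′ hS hS′ → flipFirstMismatch-injective S S′ (∧-true⁻ˡ hS) (∧-true⁻ˡ hS′))
          (λ S hS → ∧-true⁺ (unmatched-flip S (∧-true⁻ˡ hS)) (cong not (unbalanced-flip S (∧-true⁻ˡ hS) (∧-true⁻ʳ hS))))

        balancedAt-fraction : countSubsets (balancedAt N u v c) * 4 ≤ 3 * 2 ^ r
        balancedAt-fraction = three-quarters
          (countSubsets-not unmatched)
          (countSubsets-split unmatched (balancedAt N u v c))
          matched≤unmatched
          unmatched-balanced≤unbalanced
          (≤-trans (countSubsets-mono split) (countSubsets-∨ (not ∘ unmatched) (λ S → unmatched S ∧ balancedAt N u v c S)))
          where
          split : ∀ S → balancedAt N u v c S ≡ true → (not (unmatched S) ∨ (unmatched S ∧ balancedAt N u v c S)) ≡ true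
          split S balancedS with unmatched S
          ... | true  = balancedS
          ... | false = refl

      count-coset : ∀ c w → count (λ y → inCoset N c (y ∙ w)) ≡ count N
      count-coset c w = count-∘-bijection N (λ y → c ⁻¹ ∙ (y ∙ w)) (λ x → c ∙ x ∙ w ⁻¹)
        (λ x → trans (cong (c ⁻¹ ∙_) (//-rightDividesˡ w (c ∙ x))) (\\-leftDividesʳ c x))
        (λ y → trans (cong (_∙ w ⁻¹) (\\-leftDividesˡ c (y ∙ w))) (//-rightDividesʳ w y))

      neighbourhood : Fin r → Fin r → Bool
      neighbourhood c y = block c y ∨ inCoset N c (y ∙ u ⁻¹)

      count-neighbourhood : ∀ c → count (neighbourhood c) ≤ 3 * count N
      count-neighbourhood c = begin
        count (neighbourhood c)                                        ≤⟨ count-∨ (block c) _ ⟩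
        count (block c) + count (λ y → inCoset N c (y ∙ u ⁻¹))         ≤⟨ +-monoˡ-≤ _ (count-∨ (inCoset N c) _) ⟩
        count (inCoset N c) + count (λ y → inCoset N c (y ∙ u)) + count (λ y → inCoset N c (y ∙ u ⁻¹))
          ≡⟨ cong₂ _+_ (cong₂ _+_ (trans (count-cong (λ y → cong (inCoset N c) (sym (identityʳ y)))) (count-coset c ε))
                                  (count-coset c u))
                       (count-coset c (u ⁻¹)) ⟩
        count N + count N + count N                                    ≡⟨ solve 1 (λ x → x :+ x :+ x := con 3 :* x) refl (count N) ⟩
        3 * count N                                                    ∎
        where open ≤-Reasoning
              open +-*-Solver

      blocks : List (Fin r) → Fin r → Bool
      blocks []       _ = false
      blocks (c ∷ cs) y = block c y ∨ blocks cs y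

      neighbourhoods : List (Fin r) → Fin r → Bool
      neighbourhoods []       _ = false
      neighbourhoods (c ∷ cs) y = neighbourhood c y ∨ neighbourhoods cs y

      Disjoint : List (Fin r) → Set
      Disjoint []       = ⊤
      Disjoint (c ∷ cs) = (∀ y → block c y ≡ true → blocks cs y ≡ false) × Disjoint cs

      neighbourhoods-cover : ∀ cs y → blocks cs y ≡ true ⊎ blocks cs (y ∙ u ⁻¹) ≡ true → neighbourhoods cs y ≡ true
      neighbourhoods-cover (c ∷ cs) y (inj₁ inBlocks) with ∨-true⁻ {block c y} inBlocks
      ... | inj₁ inBlock = ∨-true⁺ˡ (∨-true⁺ˡ inBlock)
      ... | inj₂ inRest  = ∨-true⁺ʳ (neighbourhoods-cover cs y (inj₁ inRest))
      neighbourhoods-cover (c ∷ cs) y (inj₂ inBlocks) with ∨-true⁻ {block c (y ∙ u ⁻¹)} inBlocks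
      ... | inj₂ inRest  = ∨-true⁺ʳ (neighbourhoods-cover cs y (inj₂ inRest))
      ... | inj₁ inBlock with ∨-true⁻ {inCoset N c (y ∙ u ⁻¹)} inBlock
      ...   | inj₁ c∼yu⁻¹ = ∨-true⁺ˡ (∨-true⁺ʳ {block c y} c∼yu⁻¹)
      ...   | inj₂ c∼yu⁻¹u = ∨-true⁺ˡ (∨-true⁺ˡ (∨-true⁺ˡ (subst (λ t → inCoset N c t ≡ true) (//-rightDividesˡ u y) c∼yu⁻¹u)))

      count-neighbourhoods : ∀ cs → count (neighbourhoods cs) ≤ length cs * (3 * count N)
      count-neighbourhoods []       = ≤-reflexive (count-false r)
      count-neighbourhoods (c ∷ cs) = ≤-trans (count-∨ (neighbourhood c) (neighbourhoods cs))
        (+-mono-≤ (count-neighbourhood c) (count-neighbourhoods cs))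

      block-disjoint : ∀ cs y → blocks cs y ≡ false → blocks cs (y ∙ u ⁻¹) ≡ false →
        ∀ w → block y w ≡ true → blocks cs w ≡ false
      block-disjoint []       y _ _ w _ = refl
      block-disjoint (c ∷ cs) y y∉ yu⁻¹∉ w inBlock = ∨-false⁺ disjoint-c (block-disjoint cs y y∉′ yu⁻¹∉′ w inBlock)
        where
        y∉c : inCoset N c y ≡ false × inCoset N c (y ∙ u) ≡ false
        y∉c = ∨-false⁻ (proj₁ (∨-false⁻ y∉))
        y∉′ : blocks cs y ≡ false
        y∉′ = proj₂ (∨-false⁻ {block c y} y∉)
        yu⁻¹∉c : inCoset N c (y ∙ u ⁻¹) ≡ false
        yu⁻¹∉c = proj₁ (∨-false⁻ (proj₁ (∨-false⁻ yu⁻¹∉)))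
        yu⁻¹∉′ : blocks cs (y ∙ u ⁻¹) ≡ false
        yu⁻¹∉′ = proj₂ (∨-false⁻ {block c (y ∙ u ⁻¹)} yu⁻¹∉)
        outside : ∀ {a b} → a ∼ b → inCoset N c b ≡ false → inCoset N c a ≡ false
        outside a∼b = trans (sym (inCoset-resp c a∼b))
        disjoint-c : block c w ≡ false
        disjoint-c with ∨-true⁻ {inCoset N y w} inBlock
        ... | inj₁ y∼w  = ∨-false⁺ (outside (∼-sym y∼w) (proj₁ y∉c)) (outside (∼-∙ʳ u (∼-sym y∼w)) (proj₂ y∉c))
        ... | inj₂ y∼wu = ∨-false⁺ (outside w∼yu⁻¹ yu⁻¹∉c) (outside (∼-sym y∼wu) (proj₁ y∉c))
          where
          w∼yu⁻¹ : w ∼ (y ∙ u ⁻¹)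
          w∼yu⁻¹ = subst (_∼ (y ∙ u ⁻¹)) (//-rightDividesʳ u w) (∼-∙ʳ (u ⁻¹) (∼-sym y∼wu))

      Packing : Set
      Packing = Σ (List (Fin r)) λ cs → Disjoint cs × (∀ y → neighbourhoods cs y ≡ true)

      -- Greedily add a block centred at some y with y and y u⁻¹ both uncovered; the fuel bounds the uncovered part.
      packing : ∀ fuel cs → Disjoint cs → r ≤ count (blocks cs) + fuel → Packing
      packing fuel cs disjoint room with anyFin (λ y → not (blocks cs y) ∧ not (blocks cs (y ∙ u ⁻¹))) in free?
      ... | false = cs , disjoint , λ y → neighbourhoods-cover cs y (covered y)
        where
        covered : ∀ y → blocks cs y ≡ true ⊎ blocks cs (y ∙ u ⁻¹) ≡ true
        covered y with blocks cs y | blocks cs (y ∙ u ⁻¹) | anyFin-false⁻ _ free? y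
        ... | true  | _    | _ = inj₁ refl
        ... | false | true | _ = inj₂ refl
      ... | true with anyFin-true⁻ _ free?
      ...   | y , y-free = extend fuel room
        where
        y∉ : blocks cs y ≡ false
        y∉ = not-true⁻ (∧-true⁻ˡ y-free)
        yu⁻¹∉ : blocks cs (y ∙ u ⁻¹) ≡ false
        yu⁻¹∉ = not-true⁻ (∧-true⁻ʳ {not (blocks cs y)} y-free)
        grows : count (blocks cs) < count (blocks (y ∷ cs))
        grows = count-<⁺ (λ _ → ∨-true⁺ʳ) y y∉ (∨-true⁺ˡ (∨-true⁺ˡ (∼-refl y)))
        extend : ∀ fuel → r ≤ count (blocks cs) + fuel → Packing
        extend zero      room = ⊥-elim (<⇒≱ (≤-trans grows (count≤ (blocks (y ∷ cs)))) (subst (r ≤_) (+-identityʳ _) room))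
        extend (suc fuel) room = packing fuel (y ∷ cs) (block-disjoint cs y y∉ yu⁻¹∉ , disjoint)
          (≤-trans room (subst (_≤ count (blocks (y ∷ cs)) + fuel) (sym (+-suc _ fuel)) (+-monoˡ-≤ fuel grows)))

      balancedAtAll : List (Fin r) → Subset r → Bool
      balancedAtAll []       _ = true
      balancedAtAll (c ∷ cs) S = balancedAt N u v c S ∧ balancedAtAll cs S

      balancedAtAll-dependsOn : ∀ cs → DependsOn (blocks cs) (balancedAtAll cs)
      balancedAtAll-dependsOn []       _ _ _ = refl
      balancedAtAll-dependsOn (c ∷ cs) = DependsOn-∧ (balancedAt-dependsOn c) (balancedAtAll-dependsOn cs)

      -- Balance at disjoint blocks involves independent coordinates, so the 3/4 factors multiply.
      balancedAtAll-fraction : ∀ cs → Disjoint cs → 4 ^ length cs * countSubsets (balancedAtAll cs) ≤ 3 ^ length cs * 2 ^ r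
      balancedAtAll-fraction []       _ = ≤-reflexive (cong (_+ 0) (countSubsets-true r))
      balancedAtAll-fraction (c ∷ cs) (c-disjoint , disjoint) = begin
        4 * 4 ^ p * X        ≡⟨ solve 2 (λ f x → con 4 :* f :* x := f :* (x :* con 4)) refl (4 ^ p) X ⟩
        4 ^ p * (X * 4)      ≤⟨ *-monoʳ-≤ (4 ^ p) X*4≤3*R ⟩
        4 ^ p * (3 * R)      ≡⟨ solve 2 (λ f y → f :* (con 3 :* y) := con 3 :* (f :* y)) refl (4 ^ p) R ⟩
        3 * (4 ^ p * R)      ≤⟨ *-monoʳ-≤ 3 (balancedAtAll-fraction cs disjoint) ⟩
        3 * (3 ^ p * 2 ^ r)  ≡⟨ *-assoc 3 (3 ^ p) (2 ^ r) ⟨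
        3 * 3 ^ p * 2 ^ r    ∎
        where
        open ≤-Reasoning
        open +-*-Solver
        p = length cs
        X = countSubsets (balancedAtAll (c ∷ cs))
        R = countSubsets (balancedAtAll cs)
        Q = countSubsets (balancedAt N u v c)
        independent : X * 2 ^ r ≤ Q * R
        independent = countSubsets-independent (block c) (balancedAt N u v c) (balancedAtAll cs) (balancedAt-dependsOn c)
          (DependsOn-mono (λ y inRest → cong not (¬-not λ inBlock → true≢false (trans (sym inRest) (c-disjoint y inBlock))))
            (balancedAtAll-dependsOn cs))
        X*4≤3*R : X * 4 ≤ 3 * R
        X*4≤3*R = *-cancelʳ-≤ (X * 4) (3 * R) (2 ^ r) {{m^n≢0 2 r}} (begin
          X * 4 * 2 ^ r   ≡⟨ solve 2 (λ x t → x :* con 4 :* t := x :* t :* con 4) refl X (2 ^ r) ⟩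
          X * 2 ^ r * 4   ≤⟨ *-monoˡ-≤ 4 independent ⟩
          Q * R * 4       ≡⟨ solve 2 (λ q y → q :* y :* con 4 := q :* con 4 :* y) refl Q R ⟩
          Q * 4 * R       ≤⟨ *-monoˡ-≤ R (OneCoset.balancedAt-fraction c) ⟩
          3 * 2 ^ r * R   ≡⟨ solve 2 (λ t y → con 3 :* t :* y := con 3 :* y :* t) refl (2 ^ r) R ⟩
          3 * R * 2 ^ r   ∎)

      balancedAtAll-balanced : ∀ cs S → balanced N u v S ≡ true → balancedAtAll cs S ≡ true
      balancedAtAll-balanced []       S _          = refl
      balancedAtAll-balanced (c ∷ cs) S balancedS =
        ∧-true⁺ (allFin-true⁻ _ balancedS c) (balancedAtAll-balanced cs S balancedS)

      balanced-fraction : ∃[ p ] r ≤ p * (3 * count N) × 4 ^ p * countSubsets (balanced N u v) ≤ 3 ^ p * 2 ^ r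
      balanced-fraction with packing r [] tt (≤-reflexive (sym (cong (_+ r) (count-false r))))
      ... | cs , disjoint , covering =
        length cs ,
        ≤-trans (≤-reflexive (sym (count-true r))) (≤-trans (count-mono (λ y _ → covering y)) (count-neighbourhoods cs)) ,
        ≤-trans (*-monoʳ-≤ (4 ^ length cs) (countSubsets-mono (balancedAtAll-balanced cs))) (balancedAtAll-fraction cs disjoint)


module Generation {r : ℕ} (G : FinGroup r) where

  open GroupFacts G

  Contains : ∀ {k} → Vec (Fin r) k → Subset r → Set
  Contains gs K = Vec.All (λ g → lookup K g ≡ true) gs

  InEverySubgroupContaining : ∀ {k} → Vec (Fin r) k → Fin r → Set
  InEverySubgroupContaining gs y = ∀ K → IsSubgroupᵇ (lookup K) → Contains gs K → lookup K y ≡ true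

  InEverySubgroupContaining? : ∀ {k} (gs : Vec (Fin r) k) y → Dec (InEverySubgroupContaining gs y)
  InEverySubgroupContaining? gs y = allSubsets? λ K →
    IsSubgroupᵇ? (lookup K) →-dec Vec.all? (λ g → lookup K g ≟ᵇ true) gs →-dec (lookup K y ≟ᵇ true)

  generated : ∀ {k} → Vec (Fin r) k → Fin r → Bool
  generated gs y = does (InEverySubgroupContaining? gs y)

  generated-true⁺ : ∀ {k} (gs : Vec (Fin r) k) y → InEverySubgroupContaining gs y → generated gs y ≡ true
  generated-true⁺ gs y = dec-true (InEverySubgroupContaining? gs y)

  generated-true⁻ : ∀ {k} (gs : Vec (Fin r) k) y → generated gs y ≡ true → InEverySubgroupContaining gs y
  generated-true⁻ gs y = does-true⁻ (InEverySubgroupContaining? gs y)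

  generated-least : ∀ {k} (gs : Vec (Fin r) k) {H} → IsSubgroupᵇ H → Vec.All (λ g → H g ≡ true) gs →
    ∀ y → generated gs y ≡ true → H y ≡ true
  generated-least gs {H} isSubgroup gs⊆H y y∈ = trans (sym (lookup∘tabulate H y))
    (generated-true⁻ gs y y∈ (tabulate H) (IsSubgroupᵇ-cong (sym ∘ lookup∘tabulate H) isSubgroup)
      (Vec.map (λ {g} → trans (lookup∘tabulate H g)) gs⊆H))

  generated-isSubgroup : ∀ {k} (gs : Vec (Fin r) k) → IsSubgroupᵇ (generated gs)
  generated-isSubgroup gs = record
    { ε∈        = generated-true⁺ gs ε λ K isSubgroup _ → IsSubgroupᵇ.ε∈ isSubgroup
    ; ∙-closed  = λ {x} {y} x∈ y∈ → generated-true⁺ gs (x ∙ y) λ K isSubgroup gs⊆K →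
        IsSubgroupᵇ.∙-closed isSubgroup (generated-true⁻ gs x x∈ K isSubgroup gs⊆K) (generated-true⁻ gs y y∈ K isSubgroup gs⊆K)
    ; ⁻¹-closed = λ {x} x∈ → generated-true⁺ gs (x ⁻¹) λ K isSubgroup gs⊆K →
        IsSubgroupᵇ.⁻¹-closed isSubgroup (generated-true⁻ gs x x∈ K isSubgroup gs⊆K)
    }

  generated-∷⁺ : ∀ {k} (gs : Vec (Fin r) k) h y → generated gs y ≡ true → generated (h ∷ gs) y ≡ true
  generated-∷⁺ gs h y y∈ = generated-true⁺ (h ∷ gs) y λ { K isSubgroup (_ Vec.∷ gs⊆K) → generated-true⁻ gs y y∈ K isSubgroup gs⊆K }

  generated-head : ∀ {k} (gs : Vec (Fin r) k) h → generated (h ∷ gs) h ≡ true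
  generated-head gs h = generated-true⁺ (h ∷ gs) h λ { K _ (h∈K Vec.∷ _) → h∈K }

  generated-contains : ∀ {k} (gs : Vec (Fin r) k) → Vec.All (λ g → generated gs g ≡ true) gs
  generated-contains []       = Vec.[]
  generated-contains (h ∷ gs) = generated-head gs h Vec.∷ Vec.map (λ {g} → generated-∷⁺ gs h g) (generated-contains gs)

  generated-ε∷ : ∀ {k} (gs : Vec (Fin r) k) y → generated (ε ∷ gs) y ≡ generated gs y
  generated-ε∷ gs y = ≡-from-true⇔true
    (generated-least (ε ∷ gs) (generated-isSubgroup gs) (IsSubgroupᵇ.ε∈ (generated-isSubgroup gs) Vec.∷ generated-contains gs) y)
    (generated-∷⁺ gs ε y)

  -- H and its coset H h are disjoint translates of each other when h ∉ H.
  count-subgroup-∪-coset : ∀ {H} → IsSubgroupᵇ H → ∀ h → H h ≡ false → count H + count H ≤ count (λ y → H y ∨ H (y ∙ h ⁻¹))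
  count-subgroup-∪-coset {H} isSubgroup h h∉H = begin
    count H + count H
      ≡⟨ cong (count H +_) (count-∘-bijection H (_∙ h ⁻¹) (_∙ h) (//-rightDividesʳ h) (//-rightDividesˡ h)) ⟨
    count H + count (λ y → H (y ∙ h ⁻¹))
      ≡⟨ count-∨+count-∧ H (λ y → H (y ∙ h ⁻¹)) ⟨
    count (λ y → H y ∨ H (y ∙ h ⁻¹)) + count (λ y → H y ∧ H (y ∙ h ⁻¹))
      ≡⟨ cong (count (λ y → H y ∨ H (y ∙ h ⁻¹)) +_) (trans (count-cong disjoint) (count-false r)) ⟩
    count (λ y → H y ∨ H (y ∙ h ⁻¹)) + 0
      ≡⟨ +-identityʳ _ ⟩
    count (λ y → H y ∨ H (y ∙ h ⁻¹))
      ∎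
    where
    open ≤-Reasoning
    open IsSubgroupᵇ isSubgroup
    disjoint : ∀ y → (H y ∧ H (y ∙ h ⁻¹)) ≡ false
    disjoint y with H y in y∈
    ... | true  = ∙-∉ y∈ (⁻¹-∉ h∉H)
    ... | false = refl

  proper-subgroup-count : ∀ {H} → IsSubgroupᵇ H → ∀ h → H h ≡ false → count H + count H ≤ r
  proper-subgroup-count isSubgroup h h∉H = ≤-trans (count-subgroup-∪-coset isSubgroup h h∉H) (count≤ _)

  padGenerators : ∀ {k K} → k ≤′ K → (gs : Vec (Fin r) k) → Σ (Vec (Fin r) K) λ gs′ → ∀ y → generated gs′ y ≡ generated gs y
  padGenerators ≤′-refl        gs = gs , λ _ → refl
  padGenerators (≤′-step k≤′K) gs = let gs′ , same = padGenerators k≤′K gs in ε ∷ gs′ , λ y → trans (generated-ε∷ gs′ y) (same y)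

  GeneratingTuple : (Fin r → Bool) → Set
  GeneratingTuple H = ∃[ k ] Σ (Vec (Fin r) k) λ gs → 2 ^ k ≤ count H × (∀ y → generated gs y ≡ H y)

  -- Adding a generator outside ⟨gs⟩ at least doubles ⟨gs⟩; the fuel bounds the number of additions.
  extendGenerators : ∀ {H} → IsSubgroupᵇ H → ∀ fuel {k} (gs : Vec (Fin r) k) → (∀ y → generated gs y ≡ true → H y ≡ true) →
    2 ^ k ≤ count (generated gs) → r ≤ count (generated gs) + fuel → GeneratingTuple H
  extendGenerators {H} isSubgroup fuel {k} gs gs⊆H 2ᵏ≤ room with allFin (λ y → not (H y) ∨ generated gs y) in H⊆gs?
  ... | true = k , gs , ≤-trans 2ᵏ≤ (≤-reflexive (count-cong same)) , same
    where
    same : ∀ y → generated gs y ≡ H y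
    same y = ≡-from-true⇔true (gs⊆H y) λ y∈H → case ∨-true⁻ (allFin-true⁻ _ H⊆gs? y) of λ
      { (inj₁ y∉H) → ⊥-elim (true≢false (trans (sym y∈H) (not-true⁻ y∉H))) ; (inj₂ y∈) → y∈ }
  ... | false with allFin-false⁻ _ H⊆gs?
  ...   | h , h-new = extend fuel room
    where
    h∈H : H h ≡ true
    h∈H = not-false⁻ (proj₁ (∨-false⁻ h-new))
    h∉gs : generated gs h ≡ false
    h∉gs = proj₂ (∨-false⁻ {not (H h)} h-new)
    gs′ : Vec (Fin r) (suc k)
    gs′ = h ∷ gs
    gs′⊆H : ∀ y → generated gs′ y ≡ true → H y ≡ true
    gs′⊆H = generated-least gs′ isSubgroup (h∈H Vec.∷ Vec.map (λ {g} → gs⊆H g) (generated-contains gs))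
    doubles : ∀ y → (generated gs y ∨ generated gs (y ∙ h ⁻¹)) ≡ true → generated gs′ y ≡ true
    doubles y inEither with ∨-true⁻ {generated gs y} inEither
    ... | inj₁ y∈    = generated-∷⁺ gs h y y∈
    ... | inj₂ yh⁻¹∈ = subst (λ t → generated gs′ t ≡ true) (//-rightDividesˡ h y)
      (IsSubgroupᵇ.∙-closed (generated-isSubgroup gs′) (generated-∷⁺ gs h _ yh⁻¹∈) (generated-head gs h))
    2ᵏ⁺¹≤ : 2 ^ suc k ≤ count (generated gs′)
    2ᵏ⁺¹≤ = ≤-trans (≤-reflexive (cong (2 ^ k +_) (+-identityʳ (2 ^ k))))
      (≤-trans (+-mono-≤ 2ᵏ≤ 2ᵏ≤) (≤-trans (count-subgroup-∪-coset (generated-isSubgroup gs) h h∉gs) (count-mono doubles)))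
    grows : count (generated gs) < count (generated gs′)
    grows = count-<⁺ (generated-∷⁺ gs h) h h∉gs (generated-head gs h)
    extend : ∀ fuel → r ≤ count (generated gs) + fuel → GeneratingTuple H
    extend zero       room = ⊥-elim (<⇒≱ (≤-trans grows (count≤ _)) (subst (r ≤_) (+-identityʳ _) room))
    extend (suc fuel) room = extendGenerators isSubgroup fuel gs′ gs′⊆H 2ᵏ⁺¹≤
      (≤-trans room (subst (_≤ count (generated gs′) + fuel) (sym (+-suc _ fuel)) (+-monoˡ-≤ fuel grows)))

  generatingTuple : ∀ {H} → IsSubgroupᵇ H → GeneratingTuple H
  generatingTuple isSubgroup = extendGenerators isSubgroup r [] (generated-least [] isSubgroup Vec.[])
    (subst (_< count (generated [])) (count-false r)
      (count-<⁺ {P = λ _ → false} (λ _ ()) ε refl (IsSubgroupᵇ.ε∈ (generated-isSubgroup []))))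
    (m≤n+m r _)

  -- A generating k-tuple of a proper subgroup H has 2^(k+1) ≤ 2|H| ≤ r, so k ≤ K; pad it with ε.
  generatorsOfLength : ∀ K → (∀ k → 2 ^ suc k ≤ r → k ≤ K) → ∀ {H} → IsSubgroupᵇ H → ∀ h → H h ≡ false →
    Σ (Vec (Fin r) K) λ gs → ∀ y → generated gs y ≡ H y
  generatorsOfLength K maximal isSubgroup h h∉H with generatingTuple isSubgroup
  ... | k , gs , 2ᵏ≤∣H∣ , gs≗H with padGenerators (≤⇒≤′ (maximal k 2ᵏ⁺¹≤r)) gs
    where
    2ᵏ⁺¹≤r : 2 ^ suc k ≤ r
    2ᵏ⁺¹≤r = ≤-trans (≤-reflexive (cong (2 ^ k +_) (+-identityʳ (2 ^ k))))
      (≤-trans (+-mono-≤ 2ᵏ≤∣H∣ 2ᵏ≤∣H∣) (proper-subgroup-count isSubgroup h h∉H))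
  ...   | gsK , same = gsK , λ y → trans (same y) (gs≗H y)

module Certificates {r : ℕ} (G : FinGroup r) where

  open GroupFacts G
  open Balance G

  ∈⇒lookup : ∀ {x} {p : Subset r} → x ∈ p → lookup p x ≡ true
  ∈⇒lookup = []=⇒lookup

  lookup⇒∈ : ∀ {x} {p : Subset r} → lookup p x ≡ true → x ∈ p
  lookup⇒∈ {x} {p} = lookup⇒[]= x p

  isNormalSubgroupᵇ : ∀ {N} → IsNormalSubgroup G N → IsNormalSubgroupᵇ (lookup N)
  isNormalSubgroupᵇ normal = record
    { isSubgroup  = record
      { ε∈        = ∈⇒lookup ε∈
      ; ∙-closed  = λ x∈ y∈ → ∈⇒lookup (∙-closed (lookup⇒∈ x∈) (lookup⇒∈ y∈))
      ; ⁻¹-closed = λ x∈ → ∈⇒lookup (⁻¹-closed (lookup⇒∈ x∈))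
      }
    ; conj-closed = λ g m∈ → ∈⇒lookup (conj-closed g (lookup⇒∈ m∈))
    }
    where open IsNormalSubgroup normal

  module _ (S N : Subset r) (normal : IsNormalSubgroup G N) (f : Permutation′ r)
           (aut : IsCayleyAut G S f) (fixes : FixesOrbits G N f) where

    private
      F F⁻¹ : Fin r → Fin r
      F   = f ⟨$⟩ʳ_
      F⁻¹ = f ⟨$⟩ˡ_

    open IsNormalSubgroupᵇ (isNormalSubgroupᵇ normal)

    arc : ∀ g h → lookup S (h ∙ g ⁻¹) ≡ lookup S (F h ∙ F g ⁻¹)
    arc g h = ≡-from-true⇔true
      (λ gh → ∈⇒lookup (Equivalence.to (aut g h) (lookup⇒∈ gh)))
      (λ fgfh → ∈⇒lookup (Equivalence.from (aut g h) (lookup⇒∈ fgfh)))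

    drift : Fin r → Fin r
    drift x = x ⁻¹ ∙ F x

    drift∈N : ∀ x → lookup N (drift x) ≡ true
    drift∈N x with Equivalence.to (fixes x x) (ε , IsNormalSubgroup.ε∈ normal , sym (identityʳ x))
    ... | m , m∈N , Fx≡xm = subst (λ t → lookup N t ≡ true)
      (sym (trans (cong (x ⁻¹ ∙_) Fx≡xm) (\\-leftDividesʳ x m))) (∈⇒lookup m∈N)

    F≡∙drift : ∀ x → F x ≡ x ∙ drift x
    F≡∙drift x = sym (\\-leftDividesˡ x (F x))

    module Pair (g x : Fin r) where

      u v : Fin r
      u = x ∙ g ⁻¹
      v = F x ∙ F g ⁻¹

      -- Relabelling by y ↦ f(yg) f(g)⁻¹ preserves S and each N-coset and carries arcs from u to arcs from v.
      ψ ψ⁻¹ : Fin r → Fin r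
      ψ   y = F (y ∙ g) ∙ F g ⁻¹
      ψ⁻¹ w = F⁻¹ (w ∙ F g) ∙ g ⁻¹

      ψ∘ψ⁻¹ : ∀ w → ψ (ψ⁻¹ w) ≡ w
      ψ∘ψ⁻¹ w = begin
        F (F⁻¹ (w ∙ F g) ∙ g ⁻¹ ∙ g) ∙ F g ⁻¹   ≡⟨ cong (λ t → F t ∙ F g ⁻¹) (//-rightDividesˡ g _) ⟩
        F (F⁻¹ (w ∙ F g)) ∙ F g ⁻¹               ≡⟨ cong (_∙ F g ⁻¹) (Permutation.inverseʳ f) ⟩
        w ∙ F g ∙ F g ⁻¹                         ≡⟨ //-rightDividesʳ (F g) w ⟩
        w                                        ∎
        where open ≡-Reasoning

      ψ⁻¹∘ψ : ∀ y → ψ⁻¹ (ψ y) ≡ y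
      ψ⁻¹∘ψ y = begin
        F⁻¹ (F (y ∙ g) ∙ F g ⁻¹ ∙ F g) ∙ g ⁻¹    ≡⟨ cong (λ t → F⁻¹ t ∙ g ⁻¹) (//-rightDividesˡ (F g) _) ⟩
        F⁻¹ (F (y ∙ g)) ∙ g ⁻¹                   ≡⟨ cong (_∙ g ⁻¹) (Permutation.inverseˡ f) ⟩
        y ∙ g ∙ g ⁻¹                             ≡⟨ //-rightDividesʳ g y ⟩
        y                                        ∎
        where open ≡-Reasoning

      quotient-drift : ∀ b → (b ∙ g ⁻¹) ⁻¹ ∙ (F b ∙ F g ⁻¹) ≡ g ∙ (drift b ∙ drift g ⁻¹) ∙ g ⁻¹
      quotient-drift b = begin
        (b ∙ g ⁻¹) ⁻¹ ∙ (F b ∙ F g ⁻¹)        ≡⟨ cong (_∙ (F b ∙ F g ⁻¹)) (⁻¹-anti-homo-∙ b (g ⁻¹)) ⟩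
        g ⁻¹ ⁻¹ ∙ b ⁻¹ ∙ (F b ∙ F g ⁻¹)       ≡⟨ cong (λ t → t ∙ b ⁻¹ ∙ (F b ∙ F g ⁻¹)) (⁻¹-involutive g) ⟩
        g ∙ b ⁻¹ ∙ (F b ∙ F g ⁻¹)             ≡⟨ assoc g (b ⁻¹) (F b ∙ F g ⁻¹) ⟩
        g ∙ (b ⁻¹ ∙ (F b ∙ F g ⁻¹))           ≡⟨ cong (g ∙_) (assoc (b ⁻¹) (F b) (F g ⁻¹)) ⟨
        g ∙ (drift b ∙ F g ⁻¹)                ≡⟨ cong (λ t → g ∙ (drift b ∙ t ⁻¹)) (F≡∙drift g) ⟩
        g ∙ (drift b ∙ (g ∙ drift g) ⁻¹)      ≡⟨ cong (λ t → g ∙ (drift b ∙ t)) (⁻¹-anti-homo-∙ g (drift g)) ⟩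
        g ∙ (drift b ∙ (drift g ⁻¹ ∙ g ⁻¹))   ≡⟨ cong (g ∙_) (assoc (drift b) (drift g ⁻¹) (g ⁻¹)) ⟨
        g ∙ (drift b ∙ drift g ⁻¹ ∙ g ⁻¹)     ≡⟨ assoc g (drift b ∙ drift g ⁻¹) (g ⁻¹) ⟨
        g ∙ (drift b ∙ drift g ⁻¹) ∙ g ⁻¹     ∎
        where open ≡-Reasoning

      quotient-drift∈N : ∀ b → lookup N ((b ∙ g ⁻¹) ⁻¹ ∙ (F b ∙ F g ⁻¹)) ≡ true
      quotient-drift∈N b = subst (λ t → lookup N t ≡ true) (sym (quotient-drift b))
        (conj-closed′ g (∙-closed (drift∈N b) (⁻¹-closed (drift∈N g))))

      ψ-inCoset : ∀ c y → inCoset (lookup N) c (ψ y) ≡ inCoset (lookup N) c y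
      ψ-inCoset c y = inCoset-resp (lookup N) (isNormalSubgroupᵇ normal) c
        (subst (λ t → lookup N (t ⁻¹ ∙ ψ y) ≡ true) (//-rightDividesʳ g y) (quotient-drift∈N (y ∙ g)))

      ψ-S : ∀ y → lookup S (ψ y) ≡ lookup S y
      ψ-S y = sym (trans (cong (lookup S) (sym (//-rightDividesʳ g y))) (arc g (y ∙ g)))

      ψ-S-shift : ∀ y → lookup S (ψ y ∙ v ⁻¹) ≡ lookup S (y ∙ u ⁻¹)
      ψ-S-shift y = begin
        lookup S (ψ y ∙ v ⁻¹)                  ≡⟨ cong (lookup S) (∙-[∙⁻¹]⁻¹ (F (y ∙ g) ∙ F g ⁻¹) (F x) (F g)) ⟩
        lookup S (F (y ∙ g) ∙ F g ⁻¹ ∙ F g ∙ F x ⁻¹) ≡⟨ cong (λ t → lookup S (t ∙ F x ⁻¹)) (//-rightDividesˡ (F g) (F (y ∙ g))) ⟩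
        lookup S (F (y ∙ g) ∙ F x ⁻¹)          ≡⟨ arc x (y ∙ g) ⟨
        lookup S (y ∙ g ∙ x ⁻¹)                ≡⟨ cong (lookup S) (∙-[∙⁻¹]⁻¹ y x g) ⟨
        lookup S (y ∙ u ⁻¹)                    ∎
        where open ≡-Reasoning

      balanced-pair : balanced (lookup N) u v S ≡ true
      balanced-pair = allFin-true⁺ _ λ c → dec-true (_ ≟ _) (begin
        count (commonOutNeighbour (lookup N) u c S)
          ≡⟨ count-cong (λ y → sym (cong₂ _∧_ (ψ-inCoset c y) (cong₂ _∧_ (ψ-S y) (ψ-S-shift y)))) ⟩
        count (commonOutNeighbour (lookup N) v c S ∘ ψ)
          ≡⟨ count-∘-bijection _ ψ ψ⁻¹ ψ∘ψ⁻¹ ψ⁻¹∘ψ ⟩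
        count (commonOutNeighbour (lookup N) v c S)
          ∎)
        where open ≡-Reasoning

      u≢v : ¬ F x ≡ x ∙ g ⁻¹ ∙ F g → ¬ u ≡ v
      u≢v Fx≢ u≡v = Fx≢ (sym (trans (cong (_∙ F g) u≡v) (//-rightDividesˡ (F g) (F x))))

    moved : ¬ InRightRegular G f → ∀ g → ∃[ x ] ¬ F x ≡ x ∙ g ⁻¹ ∙ F g
    moved irregular g = ¬∀⟶∃¬ r _ (λ x → F x ≟ᶠ x ∙ g ⁻¹ ∙ F g)
      (λ translation → irregular (g ⁻¹ ∙ F g , λ x → trans (translation x) (assoc x (g ⁻¹) (F g))))

    translation-transfer : ∀ x g h → F h ≡ h ∙ g ⁻¹ ∙ F g → x ∙ h ⁻¹ ∙ F h ≡ x ∙ g ⁻¹ ∙ F g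
    translation-transfer x g h Fh≡ = begin
      x ∙ h ⁻¹ ∙ F h                ≡⟨ cong (x ∙ h ⁻¹ ∙_) Fh≡ ⟩
      x ∙ h ⁻¹ ∙ (h ∙ g ⁻¹ ∙ F g)   ≡⟨ assoc (x ∙ h ⁻¹) (h ∙ g ⁻¹) (F g) ⟨
      x ∙ h ⁻¹ ∙ (h ∙ g ⁻¹) ∙ F g   ≡⟨ cong (_∙ F g) (assoc (x ∙ h ⁻¹) h (g ⁻¹)) ⟨
      x ∙ h ⁻¹ ∙ h ∙ g ⁻¹ ∙ F g     ≡⟨ cong (λ t → t ∙ g ⁻¹ ∙ F g) (//-rightDividesˡ h x) ⟩
      x ∙ g ⁻¹ ∙ F g                ∎
      where open ≡-Reasoning

    -- Take x moved off x f(ε). If x ∉ N, the pair (ε, x) works; otherwise pick y ∉ N, and either (y, x) or (ε, y) works.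
    separatedPair : ¬ InRightRegular G f → count (lookup N) < r →
      ∃[ g ] ∃[ x ] lookup N (x ∙ g ⁻¹) ≡ false × ¬ F x ≡ x ∙ g ⁻¹ ∙ F g
    separatedPair irregular ∣N∣<r with moved irregular ε | allFin-false⁻ (lookup N) (¬-not λ all∈N →
      <⇒≢ ∣N∣<r (trans (count-cong {r} {lookup N} (allFin-true⁻ (lookup N) all∈N)) (count-true r)))
    ... | x , Fx≢ | y , y∉N with lookup N (x ∙ ε ⁻¹) in x∈?
    ...   | false = ε , x , x∈? , Fx≢
    ...   | true with F y ≟ᶠ y ∙ ε ⁻¹ ∙ F ε
    ...     | no  Fy≢ = ε , y , trans (cong (lookup N) (∙ε⁻¹ y)) y∉N , Fy≢
    ...     | yes Fy≡ = y , x , ∙-∉ (trans (cong (lookup N) (sym (∙ε⁻¹ x))) x∈?) (⁻¹-∉ y∉N) ,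
                        λ Fx≡ → Fx≢ (trans Fx≡ (translation-transfer x ε y Fy≡))

    balancedPair : ¬ InRightRegular G f → count (lookup N) < r →
      ∃[ u ] ∃[ v ] lookup N u ≡ false × lookup N (u ⁻¹ ∙ v) ≡ true × ¬ u ≡ v × balanced (lookup N) u v S ≡ true
    balancedPair irregular N<r with separatedPair irregular N<r
    ... | g , x , u∉N , Fx≢ = u , v , u∉N , quotient-drift∈N x , u≢v Fx≢ , balanced-pair
      where open Pair g x


module CertifiedSubsets {r : ℕ} (G : FinGroup r) (n : ℕ) where

  open GroupFacts G
  open Balance G
  open Generation G
  open Certificates G

  Candidate : ∀ {k} → Vec (Fin r) k → Fin r → Fin r → Set
  Candidate gs u v = IsNormalSubgroupᵇ (generated gs) × generated gs u ≡ false × generated gs (u ⁻¹ ∙ v) ≡ true ×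
                     ¬ u ≡ v × count (generated gs) ≤ n

  Candidate? : ∀ {k} (gs : Vec (Fin r) k) u v → Dec (Candidate gs u v)
  Candidate? gs u v = IsNormalSubgroupᵇ? (generated gs) ×-dec (generated gs u ≟ᵇ false) ×-dec (generated gs (u ⁻¹ ∙ v) ≟ᵇ true)
                      ×-dec ¬? (u ≟ᶠ v) ×-dec (count (generated gs) ≤? n)

  certified : ∀ {K} → Vec (Fin r) (2 + K) → Subset r → Bool
  certified (u ∷ v ∷ gs) S = does (Candidate? gs u v) ∧ balanced (generated gs) u v S

  bound : ℕ
  bound = largestAdmissible r n (2 ^ r)

  countSubsets-certified : ∀ {K} (t : Vec (Fin r) (2 + K)) → countSubsets (certified t) ≤ bound
  countSubsets-certified (u ∷ v ∷ gs) = byCandidacy (Candidate? gs u v)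
    where
    byCandidacy : (candidate? : Dec (Candidate gs u v)) → countSubsets (λ S → does candidate? ∧ balanced (generated gs) u v S) ≤ bound
    byCandidacy (no  _) = ≤-trans (≤-reflexive (countSubsets-false r)) z≤n
    byCandidacy (yes (normal , u∉N , u∼v , u≢v , ∣N∣≤n)) with Bound.balanced-fraction (generated gs) normal u v u∉N u∼v u≢v
    ... | p , r≤3p∣N∣ , fraction = largestAdmissible-maximal r n (2 ^ r) _ (countSubsets≤ (balanced (generated gs) u v))
      (fraction⇒admissible r n _ p (count (generated gs)) fraction r≤3p∣N∣ ∣N∣≤n)

  countSubsets-anyCertified : ∀ K → countSubsets (λ S → anyVec (2 + K) λ t → certified t S) ≤ r ^ (2 + K) * bound
  countSubsets-anyCertified K = countSubsets-anyVec (2 + K) certified bound countSubsets-certified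

  counted⇒certified : ∀ K → (∀ k → 2 ^ suc k ≤ r → k ≤ K) → ∀ S → Counted G n S → anyVec (2 + K) (λ t → certified t S) ≡ true
  counted⇒certified K maximal S (N , normal , _ , ∣N∣<r , ∣N∣≤n , f , aut , irregular , fixes)
    with balancedPair S N normal f aut fixes irregular (subst (_< r) (∣∣≡count N) ∣N∣<r)
  ... | u , v , u∉N , u∼v , u≢v , balancedS with generatorsOfLength K maximal (IsNormalSubgroupᵇ.isSubgroup normalᵇ) u u∉N
    where normalᵇ = isNormalSubgroupᵇ normal
  ...   | gs , gs≗N = anyVec-true⁺ (2 + K) (λ t → certified t S) (u ∷ v ∷ gs)
    (∧-true⁺ (dec-true (Candidate? gs u v) candidate) (trans (balanced-cong gs≗N u v S) balancedS))
    where
    candidate : Candidate gs u v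
    candidate = IsNormalSubgroupᵇ-cong (sym ∘ gs≗N) (isNormalSubgroupᵇ normal) ,
                trans (gs≗N u) u∉N , trans (gs≗N _) u∼v , u≢v ,
                ≤-trans (≤-reflexive (count-cong gs≗N)) (subst (_≤ n) (∣∣≡count N) ∣N∣≤n)

  length-counted : ∀ K → (∀ k → 2 ^ suc k ≤ r → k ≤ K) → ∀ {Ss} → Unique Ss → All (Counted G n) Ss →
    length Ss ≤ r ^ (2 + K) * bound
  length-counted K maximal unique counted = ≤-trans
    (length≤countSubsets _ _ unique (All.map (counted⇒certified K maximal _) counted)) (countSubsets-anyCertified K)

theorem2p5 : (r : ℕ) (R : FinGroup r) (n : ℕ) → 0 < n →
    (Ss : List (Subset r)) → Unique Ss → All (Counted R n) Ss →
    BoundHolds r n (length Ss)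
theorem2p5 r R (suc n) _ [] _ _ a (suc b) _ _ = z≤n
theorem2p5 r R n n>0 Ss@(_ ∷ _) unique counted@((_ , _ , 1<∣N∣ , ∣N∣<r , ∣N∣≤n , _) ∷ _)
  with largestExponent r (≤-trans 1<∣N∣ (<⇒≤ ∣N∣<r))
... | K , 2ᴷ⁺¹≤r , maximal = boundHolds r n K (length Ss) bound (≤-trans 1<∣N∣ ∣N∣≤n) 2ᴷ⁺¹≤r
  (length-counted K maximal unique counted)
  (largestAdmissible-admissible r n (2 ^ r) n>0)
  where open CertifiedSubsets R n
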